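{- Let $f(x)=\prod_{k\geq0}(1-x^{3^k}-x^{2\cdot 3^k})$. Then $H_n(f)\neq0$ for every positive integer $n$.
   Context: For a power series $f=\sum a_ix^i$, $H_n(f)=\det(a_{i+j})_{0\le i,j\le n-1}$. -}

module Defs where

open import Data.Nat as ℕ using (ℕ; zero; suc; _^_; _≤?_; _∸_)
open import Data.Integer as ℤ using (ℤ; 0ℤ; 1ℤ; _+_; _-_; _*_; -_)
open import Data.Fin using (Fin; zero; suc; toℕ; punchIn)
open import Relation.Nullary using (yes; no)

Series : Set
Series = ℕ → ℤ

mulFactor : ℕ → Series → Series
mulFactor m g i = g i - shift m - shift (2 ℕ.* m)
  where
  shift : ℕ → ℤ
  shift d with d ≤? i
  ... | yes _ = g (i ∸ d)
  ... | no  _ = 0ℤ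

partialProd : ℕ → Series
partialProd zero    zero    = 1ℤ
partialProd zero    (suc _) = 0ℤ
partialProd (suc K) = mulFactor (3 ^ K) (partialProd K)

-- The factors with k ≥ i+1 are 1 + O(x^{3^(i+1)}) and 3^(i+1) > i, so the
-- i-th coefficient of f equals that of the partial product over k < i+1.
fCoeff : Series
fCoeff i = partialProd (suc i) i

sumFin : (n : ℕ) → (Fin n → ℤ) → ℤ
sumFin zero    _ = 0ℤ
sumFin (suc n) h = h zero + sumFin n (λ j → h (suc j))

sign : ℕ → ℤ
sign zero    = 1ℤ
sign (suc k) = - sign k

det : (n : ℕ) → (Fin n → Fin n → ℤ) → ℤ
det zero    M = 1ℤ
det (suc n) M =
  sumFin (suc n) (λ j → sign (toℕ j) * (M zero j * det n (λ r c → M (suc r) (punchIn j c))))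

hankel : ℕ → Series → ℤ
hankel n a = det n (λ i j → a (toℕ i ℕ.+ toℕ j))

-- Work modulo 3. There cubing is additive, so the partial products
-- P_K = ∏_{k<K} (1 - x^{3^k} - x^{2·3^k}) satisfy P_{K+1}(x) = φ(x) P_K(x³) = φ P_K³ with
-- φ = 1 - x - x², and c = f mod 3 solves c = φ c³. Hence d = φ c is the inverse of c and
-- d² = φ; putting d = 1 + x - x y turns this into y = x (1 - y - y²). The numbers
-- l n k = [xⁿ] c yᵏ then form a Stieltjes tableau with b_k = -1 and Λ_k = ±1, which
-- factors the Hankel matrix of c as L W Lᵀ with L unitriangular and W = diag(w_k),
-- w_k = ±1. So H_n(f) ≡ ±1 (mod 3).
module Submission where

open import Defs
open import Data.Nat using (ℕ; suc)
open import Data.Integer using (0ℤ)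
open import Relation.Binary.PropositionalEquality using (_≢_)

open import Algebra.Bundles using (CommutativeRing)
import Algebra.Properties.Monoid.Sum as MonoidSum
import Algebra.Properties.Semiring.Exp as SemiringExp
import Algebra.Properties.Semiring.Sum as SemiringSum
import Algebra.Solver.Ring
import Algebra.Solver.Ring.AlmostCommutativeRing as Classical
open import Data.Empty using (⊥-elim)
open import Data.Fin as Fin using (Fin; zero; suc; toℕ; punchIn; punchOut; inject₁)
import Data.Fin.Properties as Fin
open import Data.Integer as ℤ using (ℤ; +_; -[1+_]; 1ℤ)
import Data.Integer.Properties as ℤ
open import Data.Maybe using (Maybe; just; nothing)
open import Data.Nat as ℕ using (zero; _≤?_; _∸_; _^_)
import Data.Nat.Properties as ℕ
open import Data.Product using (_,_)
open import Function using (_∘_)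
open import Relation.Binary.Definitions using (tri<; tri≈; tri>)
open import Relation.Binary.PropositionalEquality
  using (_≡_; _≗_; refl; sym; trans; cong; cong₂; subst; isEquivalence; module ≡-Reasoning)
import Relation.Binary.Reasoning.Setoid as SetoidReasoning
open import Relation.Nullary using (yes; no)
open import Tactic.RingSolver using (solve-∀)
import Tactic.RingSolver.Core.AlmostCommutativeRing as Reflective

-- The field F₃

data F₃ : Set where
  0₃ 1₃ 2₃ : F₃

infixl 6 _+₃_
infixl 7 _*₃_
infix 8 -₃_

_+₃_ : F₃ → F₃ → F₃
0₃ +₃ b  = b
1₃ +₃ 0₃ = 1₃
1₃ +₃ 1₃ = 2₃
1₃ +₃ 2₃ = 0₃
2₃ +₃ 0₃ = 2₃
2₃ +₃ 1₃ = 0₃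
2₃ +₃ 2₃ = 1₃

_*₃_ : F₃ → F₃ → F₃
0₃ *₃ b  = 0₃
1₃ *₃ b  = b
2₃ *₃ 0₃ = 0₃
2₃ *₃ 1₃ = 2₃
2₃ *₃ 2₃ = 1₃

-₃_ : F₃ → F₃
-₃ 0₃ = 0₃
-₃ 1₃ = 2₃
-₃ 2₃ = 1₃

F₃-elim : {P : F₃ → Set} → P 0₃ → P 1₃ → P 2₃ → ∀ a → P a
F₃-elim p₀ _ _ 0₃ = p₀
F₃-elim _ p₁ _ 1₃ = p₁
F₃-elim _ _ p₂ 2₃ = p₂

+₃-assoc : ∀ a b c → (a +₃ b) +₃ c ≡ a +₃ (b +₃ c)
+₃-assoc = F₃-elim (λ _ _ → refl)
  (F₃-elim (F₃-elim refl refl refl) (F₃-elim refl refl refl) (F₃-elim refl refl refl))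
  (F₃-elim (F₃-elim refl refl refl) (F₃-elim refl refl refl) (F₃-elim refl refl refl))

+₃-comm : ∀ a b → a +₃ b ≡ b +₃ a
+₃-comm = F₃-elim (F₃-elim refl refl refl) (F₃-elim refl refl refl) (F₃-elim refl refl refl)

+₃-identityʳ : ∀ a → a +₃ 0₃ ≡ a
+₃-identityʳ = F₃-elim refl refl refl

-₃-inverseˡ : ∀ a → -₃ a +₃ a ≡ 0₃
-₃-inverseˡ = F₃-elim refl refl refl

-₃-inverseʳ : ∀ a → a +₃ -₃ a ≡ 0₃
-₃-inverseʳ = F₃-elim refl refl refl

*₃-assoc : ∀ a b c → (a *₃ b) *₃ c ≡ a *₃ (b *₃ c)
*₃-assoc = F₃-elim (λ _ _ → refl) (λ _ _ → refl)
  (F₃-elim (F₃-elim refl refl refl) (F₃-elim refl refl refl) (F₃-elim refl refl refl))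

*₃-comm : ∀ a b → a *₃ b ≡ b *₃ a
*₃-comm = F₃-elim (F₃-elim refl refl refl) (F₃-elim refl refl refl) (F₃-elim refl refl refl)

*₃-identityʳ : ∀ a → a *₃ 1₃ ≡ a
*₃-identityʳ = F₃-elim refl refl refl

*₃-zeroʳ : ∀ a → a *₃ 0₃ ≡ 0₃
*₃-zeroʳ = F₃-elim refl refl refl

*₃-distribˡ-+₃ : ∀ a b c → a *₃ (b +₃ c) ≡ a *₃ b +₃ a *₃ c
*₃-distribˡ-+₃ = F₃-elim (λ _ _ → refl) (λ _ _ → refl)
  (F₃-elim (F₃-elim refl refl refl) (F₃-elim refl refl refl) (F₃-elim refl refl refl))

*₃-distribʳ-+₃ : ∀ a b c → (b +₃ c) *₃ a ≡ b *₃ a +₃ c *₃ a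
*₃-distribʳ-+₃ a b c = begin
  (b +₃ c) *₃ a       ≡⟨ *₃-comm (b +₃ c) a ⟩
  a *₃ (b +₃ c)       ≡⟨ *₃-distribˡ-+₃ a b c ⟩
  a *₃ b +₃ a *₃ c    ≡⟨ cong₂ _+₃_ (*₃-comm a b) (*₃-comm a c) ⟩
  b *₃ a +₃ c *₃ a    ∎
  where open ≡-Reasoning

F₃-commutativeRing : CommutativeRing _ _
F₃-commutativeRing = record
  { Carrier = F₃ ; _≈_ = _≡_ ; _+_ = _+₃_ ; _*_ = _*₃_ ; -_ = -₃_ ; 0# = 0₃ ; 1# = 1₃
  ; isCommutativeRing = record
    { isRing = record
      { +-isAbelianGroup = record
        { isGroup = record
          { isMonoid = record
            { isSemigroup = record
              { isMagma = record { isEquivalence = isEquivalence ; ∙-cong = cong₂ _+₃_ }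
              ; assoc = +₃-assoc }
            ; identity = (λ _ → refl) , +₃-identityʳ }
          ; inverse = -₃-inverseˡ , -₃-inverseʳ
          ; ⁻¹-cong = cong -₃_ }
        ; comm = +₃-comm }
      ; *-cong = cong₂ _*₃_
      ; *-assoc = *₃-assoc
      ; *-identity = (λ _ → refl) , *₃-identityʳ
      ; distrib = *₃-distribˡ-+₃ , *₃-distribʳ-+₃ }
    ; *-comm = *₃-comm } }

F₃-ring : Reflective.AlmostCommutativeRing _ _
F₃-ring = Reflective.fromCommutativeRing F₃-commutativeRing (λ { 0₃ → just refl ; _ → nothing })

a≡-a⇒a≡0 : ∀ a → a ≡ -₃ a → a ≡ 0₃
a≡-a⇒a≡0 0₃ _  = refl
a≡-a⇒a≡0 1₃ ()
a≡-a⇒a≡0 2₃ ()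

*₃-nonzero : ∀ a b → a ≢ 0₃ → b ≢ 0₃ → a *₃ b ≢ 0₃
*₃-nonzero 0₃ _  a≢0 _   = λ _ → a≢0 refl
*₃-nonzero 1₃ b  _   b≢0 = b≢0
*₃-nonzero 2₃ 0₃ _   b≢0 = λ _ → b≢0 refl
*₃-nonzero 2₃ 1₃ _   _   = λ ()
*₃-nonzero 2₃ 2₃ _   _   = λ ()

-₃-involutive : ∀ a → -₃ -₃ a ≡ a
-₃-involutive = F₃-elim refl refl refl

-- Reduction modulo 3

fromℕ₃ : ℕ → F₃
fromℕ₃ zero    = 0₃
fromℕ₃ (suc n) = 1₃ +₃ fromℕ₃ n

mod₃ : ℤ → F₃
mod₃ (+ n)    = fromℕ₃ n
mod₃ -[1+ n ] = -₃ fromℕ₃ (suc n)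

mod₃-neg : ∀ i → mod₃ (ℤ.- i) ≡ -₃ mod₃ i
mod₃-neg (+ zero)  = refl
mod₃-neg (+ suc n) = refl
mod₃-neg -[1+ n ]  = sym (-₃-involutive (fromℕ₃ (suc n)))

mod₃-suc : ∀ i → mod₃ (1ℤ ℤ.+ i) ≡ 1₃ +₃ mod₃ i
mod₃-suc (+ n)        = refl
mod₃-suc -[1+ zero ]  = refl
mod₃-suc -[1+ suc n ] = -1-a≡1-2-a (fromℕ₃ n)
  where
  -1-a≡1-2-a : ∀ a → -₃ (1₃ +₃ a) ≡ 1₃ +₃ -₃ (1₃ +₃ (1₃ +₃ a))
  -1-a≡1-2-a = solve-∀ F₃-ring

mod₃-ℕ+ : ∀ m j → mod₃ (+ m ℤ.+ j) ≡ fromℕ₃ m +₃ mod₃ j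
mod₃-ℕ+ zero    j = cong mod₃ (ℤ.+-identityˡ j)
mod₃-ℕ+ (suc m) j = begin
  mod₃ ((1ℤ ℤ.+ + m) ℤ.+ j)   ≡⟨ cong mod₃ (ℤ.+-assoc 1ℤ (+ m) j) ⟩
  mod₃ (1ℤ ℤ.+ (+ m ℤ.+ j))   ≡⟨ mod₃-suc (+ m ℤ.+ j) ⟩
  1₃ +₃ mod₃ (+ m ℤ.+ j)      ≡⟨ cong (1₃ +₃_) (mod₃-ℕ+ m j) ⟩
  1₃ +₃ (fromℕ₃ m +₃ mod₃ j)  ≡⟨ +₃-assoc 1₃ (fromℕ₃ m) (mod₃ j) ⟨
  fromℕ₃ (suc m) +₃ mod₃ j    ∎
  where open ≡-Reasoning

mod₃-+ : ∀ i j → mod₃ (i ℤ.+ j) ≡ mod₃ i +₃ mod₃ j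
mod₃-+ (+ m)    j = mod₃-ℕ+ m j
mod₃-+ -[1+ m ] j = begin
  mod₃ (ℤ.- + suc m ℤ.+ j)                ≡⟨ cong mod₃ (ℤ.neg-involutive (ℤ.- + suc m ℤ.+ j)) ⟨
  mod₃ (ℤ.- ℤ.- (ℤ.- + suc m ℤ.+ j))      ≡⟨ mod₃-neg (ℤ.- (ℤ.- + suc m ℤ.+ j)) ⟩
  -₃ mod₃ (ℤ.- (ℤ.- + suc m ℤ.+ j))       ≡⟨ cong (λ k → -₃ mod₃ k) (ℤ.neg-distrib-+ (ℤ.- + suc m) j) ⟩
  -₃ mod₃ (ℤ.- ℤ.- + suc m ℤ.+ ℤ.- j)     ≡⟨ cong (λ k → -₃ mod₃ (k ℤ.+ ℤ.- j)) (ℤ.neg-involutive (+ suc m)) ⟩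
  -₃ mod₃ (+ suc m ℤ.+ ℤ.- j)             ≡⟨ cong -₃_ (mod₃-ℕ+ (suc m) (ℤ.- j)) ⟩
  -₃ (fromℕ₃ (suc m) +₃ mod₃ (ℤ.- j))     ≡⟨ cong (λ a → -₃ (fromℕ₃ (suc m) +₃ a)) (mod₃-neg j) ⟩
  -₃ (fromℕ₃ (suc m) +₃ -₃ mod₃ j)        ≡⟨ -a-b≡-a+b (fromℕ₃ (suc m)) (mod₃ j) ⟩
  -₃ fromℕ₃ (suc m) +₃ mod₃ j             ∎
  where
  open ≡-Reasoning
  -a-b≡-a+b : ∀ a b → -₃ (a +₃ -₃ b) ≡ -₃ a +₃ b
  -a-b≡-a+b = solve-∀ F₃-ring

mod₃-ℕ* : ∀ m j → mod₃ (+ m ℤ.* j) ≡ fromℕ₃ m *₃ mod₃ j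
mod₃-ℕ* zero    j = refl
mod₃-ℕ* (suc m) j = begin
  mod₃ ((1ℤ ℤ.+ + m) ℤ.* j)             ≡⟨ cong mod₃ (ℤ.*-distribʳ-+ j 1ℤ (+ m)) ⟩
  mod₃ (1ℤ ℤ.* j ℤ.+ + m ℤ.* j)         ≡⟨ mod₃-+ (1ℤ ℤ.* j) (+ m ℤ.* j) ⟩
  mod₃ (1ℤ ℤ.* j) +₃ mod₃ (+ m ℤ.* j)   ≡⟨ cong₂ _+₃_ (cong mod₃ (ℤ.*-identityˡ j)) (mod₃-ℕ* m j) ⟩
  mod₃ j +₃ fromℕ₃ m *₃ mod₃ j          ≡⟨ *₃-distribʳ-+₃ (mod₃ j) 1₃ (fromℕ₃ m) ⟨
  fromℕ₃ (suc m) *₃ mod₃ j              ∎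
  where open ≡-Reasoning

mod₃-* : ∀ i j → mod₃ (i ℤ.* j) ≡ mod₃ i *₃ mod₃ j
mod₃-* (+ m)    j = mod₃-ℕ* m j
mod₃-* -[1+ m ] j = begin
  mod₃ (ℤ.- + suc m ℤ.* j)              ≡⟨ cong mod₃ (ℤ.neg-distribˡ-* (+ suc m) j) ⟨
  mod₃ (ℤ.- (+ suc m ℤ.* j))            ≡⟨ mod₃-neg (+ suc m ℤ.* j) ⟩
  -₃ mod₃ (+ suc m ℤ.* j)               ≡⟨ cong -₃_ (mod₃-ℕ* (suc m) j) ⟩
  -₃ (fromℕ₃ (suc m) *₃ mod₃ j)         ≡⟨ -[a*b]≡-a*b (fromℕ₃ (suc m)) (mod₃ j) ⟩
  -₃ fromℕ₃ (suc m) *₃ mod₃ j           ∎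
  where
  open ≡-Reasoning
  -[a*b]≡-a*b : ∀ a b → -₃ (a *₃ b) ≡ -₃ a *₃ b
  -[a*b]≡-a*b = solve-∀ F₃-ring

mod₃-- : ∀ i j → mod₃ (i ℤ.- j) ≡ mod₃ i +₃ -₃ mod₃ j
mod₃-- i j = trans (mod₃-+ i (ℤ.- j)) (cong (mod₃ i +₃_) (mod₃-neg j))

mod₃-−− : ∀ a b c → mod₃ (a ℤ.- b ℤ.- c) ≡ mod₃ a +₃ -₃ mod₃ b +₃ -₃ mod₃ c
mod₃-−− a b c = trans (mod₃-- (a ℤ.- b) c) (cong (_+₃ -₃ mod₃ c) (mod₃-- a b))

-- Determinants over F₃

open SemiringSum (CommutativeRing.semiring F₃-commutativeRing)
  using (sum; sum-cong-≗; sum-remove; sum-replicate-zero; ∑-distrib-+; *-distribˡ-sum)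
open MonoidSum (CommutativeRing.*-monoid F₃-commutativeRing)
  using () renaming (sum to product; sum-cong-≗ to product-cong-≗)

Matrix₃ : ℕ → Set
Matrix₃ n = Fin n → Fin n → F₃

sign₃ : ℕ → F₃
sign₃ zero    = 1₃
sign₃ (suc k) = -₃ sign₃ k

minor : ∀ {n} → Matrix₃ (suc n) → Fin (suc n) → Matrix₃ n
minor M j r c = M (suc r) (punchIn j c)

cofactorTerm : ∀ {n} → (Matrix₃ n → F₃) → Matrix₃ (suc n) → Fin (suc n) → F₃
cofactorTerm d M j = sign₃ (toℕ j) *₃ (M zero j *₃ d (minor M j))

det₃ : (n : ℕ) → Matrix₃ n → F₃
det₃ zero    M = 1₃
det₃ (suc n) M = sum (cofactorTerm (det₃ n) M)

mod₃-sum : ∀ n (h : Fin n → ℤ) → mod₃ (sumFin n h) ≡ sum (λ j → mod₃ (h j))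
mod₃-sum zero    h = refl
mod₃-sum (suc n) h = trans (mod₃-+ (h zero) _) (cong (mod₃ (h zero) +₃_) (mod₃-sum n (λ j → h (suc j))))

mod₃-sign : ∀ k → mod₃ (sign k) ≡ sign₃ k
mod₃-sign zero    = refl
mod₃-sign (suc k) = trans (mod₃-neg (sign k)) (cong -₃_ (mod₃-sign k))

mod₃-det : ∀ n (M : Fin n → Fin n → ℤ) → mod₃ (det n M) ≡ det₃ n (λ r c → mod₃ (M r c))
mod₃-det zero    M = refl
mod₃-det (suc n) M = trans (mod₃-sum (suc n) termℤ) (sum-cong-≗ term)
  where
  M₃ : Matrix₃ (suc n)
  M₃ r c = mod₃ (M r c)
  minorℤ : Fin (suc n) → Fin n → Fin n → ℤ
  minorℤ j r c = M (suc r) (punchIn j c)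
  termℤ : Fin (suc n) → ℤ
  termℤ j = sign (toℕ j) ℤ.* (M zero j ℤ.* det n (minorℤ j))
  term : ∀ j → mod₃ (termℤ j) ≡ cofactorTerm (det₃ n) M₃ j
  term j = begin
    mod₃ (sign (toℕ j) ℤ.* (M zero j ℤ.* det n (minorℤ j)))
      ≡⟨ mod₃-* (sign (toℕ j)) _ ⟩
    mod₃ (sign (toℕ j)) *₃ mod₃ (M zero j ℤ.* det n (minorℤ j))
      ≡⟨ cong₂ _*₃_ (mod₃-sign (toℕ j)) (mod₃-* (M zero j) _) ⟩
    sign₃ (toℕ j) *₃ (M₃ zero j *₃ mod₃ (det n (minorℤ j)))
      ≡⟨ cong (λ d → sign₃ (toℕ j) *₃ (M₃ zero j *₃ d)) (mod₃-det n (minorℤ j)) ⟩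
    cofactorTerm (det₃ n) M₃ j  ∎
    where open ≡-Reasoning

det₃-cong : ∀ n {M N : Matrix₃ n} → (∀ r c → M r c ≡ N r c) → det₃ n M ≡ det₃ n N
det₃-cong zero    M≡N = refl
det₃-cong (suc n) M≡N = sum-cong-≗ λ j →
  cong₂ (λ a d → sign₃ (toℕ j) *₃ (a *₃ d)) (M≡N zero j) (det₃-cong n (λ r c → M≡N (suc r) (punchIn j c)))

punchIn≢ : ∀ {n} {j t : Fin (suc n)} (j≢t : j ≢ t) c → c ≢ punchOut j≢t → punchIn j c ≢ t
punchIn≢ {j = j} j≢t c c≢ eq =
  c≢ (Fin.punchIn-injective j c (punchOut j≢t) (trans eq (sym (Fin.punchIn-punchOut j≢t))))

det₃-linear : ∀ n (M N P : Matrix₃ n) (t : Fin n) β →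
  (∀ r j → j ≢ t → P r j ≡ M r j) → (∀ r j → j ≢ t → N r j ≡ M r j) →
  (∀ r → P r t ≡ M r t +₃ β *₃ N r t) → det₃ n P ≡ det₃ n M +₃ β *₃ det₃ n N
det₃-linear (suc n) M N P t β P≡M N≡M Pt = begin
  sum (cofactorTerm (det₃ n) P)
    ≡⟨ sum-cong-≗ term ⟩
  sum (λ j → cofactorTerm (det₃ n) M j +₃ β *₃ cofactorTerm (det₃ n) N j)
    ≡⟨ ∑-distrib-+ (cofactorTerm (det₃ n) M) (λ j → β *₃ cofactorTerm (det₃ n) N j) ⟩
  det₃ (suc n) M +₃ sum (λ j → β *₃ cofactorTerm (det₃ n) N j)
    ≡⟨ cong (det₃ (suc n) M +₃_) (*-distribˡ-sum β (cofactorTerm (det₃ n) N)) ⟨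
  det₃ (suc n) M +₃ β *₃ det₃ (suc n) N  ∎
  where
  open ≡-Reasoning
  split-column : ∀ s m b x d → s *₃ ((m +₃ b *₃ x) *₃ d) ≡ s *₃ (m *₃ d) +₃ b *₃ (s *₃ (x *₃ d))
  split-column = solve-∀ F₃-ring
  split-minor : ∀ s m d b e → s *₃ (m *₃ (d +₃ b *₃ e)) ≡ s *₃ (m *₃ d) +₃ b *₃ (s *₃ (m *₃ e))
  split-minor = solve-∀ F₃-ring
  term : ∀ j → cofactorTerm (det₃ n) P j ≡ cofactorTerm (det₃ n) M j +₃ β *₃ cofactorTerm (det₃ n) N j
  term j with j Fin.≟ t
  ... | yes refl = begin
    sign₃ (toℕ j) *₃ (P zero j *₃ det₃ n (minor P j))
      ≡⟨ cong₂ (λ a d → sign₃ (toℕ j) *₃ (a *₃ d)) (Pt zero)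
               (det₃-cong n (λ r c → P≡M (suc r) (punchIn j c) (Fin.punchInᵢ≢i j c))) ⟩
    sign₃ (toℕ j) *₃ ((M zero j +₃ β *₃ N zero j) *₃ det₃ n (minor M j))
      ≡⟨ split-column (sign₃ (toℕ j)) (M zero j) β (N zero j) _ ⟩
    cofactorTerm (det₃ n) M j +₃ β *₃ (sign₃ (toℕ j) *₃ (N zero j *₃ det₃ n (minor M j)))
      ≡⟨ cong (λ d → cofactorTerm (det₃ n) M j +₃ β *₃ (sign₃ (toℕ j) *₃ (N zero j *₃ d)))
              (det₃-cong n (λ r c → N≡M (suc r) (punchIn j c) (Fin.punchInᵢ≢i j c))) ⟨
    cofactorTerm (det₃ n) M j +₃ β *₃ cofactorTerm (det₃ n) N j  ∎
  ... | no j≢t = begin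
    sign₃ (toℕ j) *₃ (P zero j *₃ det₃ n (minor P j))
      ≡⟨ cong₂ (λ a d → sign₃ (toℕ j) *₃ (a *₃ d)) (P≡M zero j j≢t) minor-linear ⟩
    sign₃ (toℕ j) *₃ (M zero j *₃ (det₃ n (minor M j) +₃ β *₃ det₃ n (minor N j)))
      ≡⟨ split-minor (sign₃ (toℕ j)) (M zero j) _ β _ ⟩
    cofactorTerm (det₃ n) M j +₃ β *₃ (sign₃ (toℕ j) *₃ (M zero j *₃ det₃ n (minor N j)))
      ≡⟨ cong (λ a → cofactorTerm (det₃ n) M j +₃ β *₃ (sign₃ (toℕ j) *₃ (a *₃ det₃ n (minor N j))))
              (N≡M zero j j≢t) ⟨
    cofactorTerm (det₃ n) M j +₃ β *₃ cofactorTerm (det₃ n) N j  ∎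
    where
    minor-linear : det₃ n (minor P j) ≡ det₃ n (minor M j) +₃ β *₃ det₃ n (minor N j)
    minor-linear = det₃-linear n (minor M j) (minor N j) (minor P j) (punchOut j≢t) β
      (λ r c c≢ → P≡M (suc r) (punchIn j c) (punchIn≢ j≢t c c≢))
      (λ r c c≢ → N≡M (suc r) (punchIn j c) (punchIn≢ j≢t c c≢))
      (λ r → subst (λ k → P (suc r) k ≡ M (suc r) k +₃ β *₃ N (suc r) k)
                   (sym (Fin.punchIn-punchOut j≢t)) (Pt (suc r)))

swapWithNext : ∀ {n} → Fin n → Fin (suc n) → Fin (suc n)
swapWithNext zero    zero          = suc zero
swapWithNext zero    (suc zero)    = zero
swapWithNext zero    (suc (suc j)) = suc (suc j)
swapWithNext (suc a) zero          = zero
swapWithNext (suc a) (suc j)       = suc (swapWithNext a j)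

swapWithNext-inject₁ : ∀ {n} (a : Fin n) → swapWithNext a (inject₁ a) ≡ suc a
swapWithNext-inject₁ zero    = refl
swapWithNext-inject₁ (suc a) = cong suc (swapWithNext-inject₁ a)

swapWithNext-suc : ∀ {n} (a : Fin n) → swapWithNext a (suc a) ≡ inject₁ a
swapWithNext-suc zero    = refl
swapWithNext-suc (suc a) = cong suc (swapWithNext-suc a)

swapWithNext-punchIn-inject₁ : ∀ {n} (a : Fin n) c → swapWithNext a (punchIn (inject₁ a) c) ≡ punchIn (suc a) c
swapWithNext-punchIn-inject₁ zero    zero    = refl
swapWithNext-punchIn-inject₁ zero    (suc c) = refl
swapWithNext-punchIn-inject₁ (suc a) zero    = refl
swapWithNext-punchIn-inject₁ (suc a) (suc c) = cong suc (swapWithNext-punchIn-inject₁ a c)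

swapWithNext-punchIn-suc : ∀ {n} (a : Fin n) c → swapWithNext a (punchIn (suc a) c) ≡ punchIn (inject₁ a) c
swapWithNext-punchIn-suc zero    zero    = refl
swapWithNext-punchIn-suc zero    (suc c) = refl
swapWithNext-punchIn-suc (suc a) zero    = refl
swapWithNext-punchIn-suc (suc a) (suc c) = cong suc (swapWithNext-punchIn-suc a c)

-- Away from the swapped pair, deleting column j commutes with the swap, which
-- becomes a swap a′ of the remaining columns.
data SwapView {m} (a : Fin (suc m)) : Fin (suc (suc m)) → Set where
  left  : SwapView a (inject₁ a)
  right : SwapView a (suc a)
  away  : ∀ {j} (a′ : Fin m) → swapWithNext a j ≡ j →
          (∀ c → swapWithNext a (punchIn j c) ≡ punchIn j (swapWithNext a′ c)) → SwapView a j

swapView : ∀ {m} (a : Fin (suc m)) j → SwapView a j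
swapView zero          zero                = left
swapView zero          (suc zero)          = right
swapView {suc m} zero  (suc (suc j))       = away zero refl commute
  where
  commute : ∀ c → swapWithNext zero (punchIn (suc (suc j)) c) ≡ punchIn (suc (suc j)) (swapWithNext zero c)
  commute zero          = refl
  commute (suc zero)    = refl
  commute (suc (suc c)) = refl
swapView {suc m} (suc a) zero              = away a refl (λ _ → refl)
swapView {suc m} (suc a) (suc j) with swapView a j
... | left                = left
... | right               = right
... | away a′ fixed commute = away (suc a′) (cong suc fixed) commute′
  where
  commute′ : ∀ c → swapWithNext (suc a) (punchIn (suc j) c) ≡ punchIn (suc j) (swapWithNext (suc a′) c)
  commute′ zero    = refl
  commute′ (suc c) = cong suc (commute c)

sum-swapWithNext : ∀ {n} (a : Fin n) (f : Fin (suc n) → F₃) → sum (λ j → f (swapWithNext a j)) ≡ sum f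
sum-swapWithNext zero    f = swap-front (f (suc zero)) (f zero) _
  where
  swap-front : ∀ x y z → x +₃ (y +₃ z) ≡ y +₃ (x +₃ z)
  swap-front = solve-∀ F₃-ring
sum-swapWithNext (suc a) f = cong (f zero +₃_) (sum-swapWithNext a (λ j → f (suc j)))

sum-neg : ∀ {n} (f : Fin n → F₃) → sum (λ j → -₃ f j) ≡ -₃ sum f
sum-neg {zero}  f = refl
sum-neg {suc n} f = trans (cong (-₃ f zero +₃_) (sum-neg (λ j → f (suc j)))) (neg-+ (f zero) _)
  where
  neg-+ : ∀ x y → -₃ x +₃ -₃ y ≡ -₃ (x +₃ y)
  neg-+ = solve-∀ F₃-ring

det₃-swapWithNext : ∀ n (a : Fin n) (M : Matrix₃ (suc n)) →
  det₃ (suc n) (λ r c → M r (swapWithNext a c)) ≡ -₃ det₃ (suc n) M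
det₃-swapWithNext (suc m) a M = begin
  sum (cofactorTerm (det₃ (suc m)) M′)
    ≡⟨ sum-cong-≗ term ⟩
  sum (λ j → -₃ cofactorTerm (det₃ (suc m)) M (swapWithNext a j))
    ≡⟨ sum-neg (λ j → cofactorTerm (det₃ (suc m)) M (swapWithNext a j)) ⟩
  -₃ sum (λ j → cofactorTerm (det₃ (suc m)) M (swapWithNext a j))
    ≡⟨ cong -₃_ (sum-swapWithNext a (cofactorTerm (det₃ (suc m)) M)) ⟩
  -₃ det₃ (suc (suc m)) M  ∎
  where
  open ≡-Reasoning
  M′ : Matrix₃ (suc (suc m))
  M′ r c = M r (swapWithNext a c)
  sign-inject₁ : sign₃ (toℕ (inject₁ a)) ≡ sign₃ (toℕ a)
  sign-inject₁ = cong sign₃ (Fin.toℕ-inject₁ a)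
  flip-sign : ∀ s x → s *₃ x ≡ -₃ (-₃ s *₃ x)
  flip-sign = solve-∀ F₃-ring
  neg-*ˡ : ∀ s x → -₃ s *₃ x ≡ -₃ (s *₃ x)
  neg-*ˡ = solve-∀ F₃-ring
  neg-inside : ∀ s x d → s *₃ (x *₃ -₃ d) ≡ -₃ (s *₃ (x *₃ d))
  neg-inside = solve-∀ F₃-ring
  term : ∀ j → cofactorTerm (det₃ (suc m)) M′ j ≡ -₃ cofactorTerm (det₃ (suc m)) M (swapWithNext a j)
  term j with swapView a j
  ... | left = begin
    sign₃ (toℕ (inject₁ a)) *₃ (M′ zero (inject₁ a) *₃ det₃ (suc m) (minor M′ (inject₁ a)))
      ≡⟨ cong₂ (λ s d → s *₃ (M′ zero (inject₁ a) *₃ d)) sign-inject₁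
           (det₃-cong (suc m) (λ r c → cong (M (suc r)) (swapWithNext-punchIn-inject₁ a c))) ⟩
    sign₃ (toℕ a) *₃ (M′ zero (inject₁ a) *₃ det₃ (suc m) (minor M (suc a)))
      ≡⟨ cong (λ k → sign₃ (toℕ a) *₃ (M zero k *₃ det₃ (suc m) (minor M (suc a)))) (swapWithNext-inject₁ a) ⟩
    sign₃ (toℕ a) *₃ (M zero (suc a) *₃ det₃ (suc m) (minor M (suc a)))
      ≡⟨ flip-sign (sign₃ (toℕ a)) _ ⟩
    -₃ cofactorTerm (det₃ (suc m)) M (suc a)
      ≡⟨ cong (λ k → -₃ cofactorTerm (det₃ (suc m)) M k) (swapWithNext-inject₁ a) ⟨
    -₃ cofactorTerm (det₃ (suc m)) M (swapWithNext a (inject₁ a))  ∎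
  ... | right = begin
    -₃ sign₃ (toℕ a) *₃ (M′ zero (suc a) *₃ det₃ (suc m) (minor M′ (suc a)))
      ≡⟨ cong₂ (λ k d → -₃ sign₃ (toℕ a) *₃ (M zero k *₃ d)) (swapWithNext-suc a)
           (det₃-cong (suc m) (λ r c → cong (M (suc r)) (swapWithNext-punchIn-suc a c))) ⟩
    -₃ sign₃ (toℕ a) *₃ (M zero (inject₁ a) *₃ det₃ (suc m) (minor M (inject₁ a)))
      ≡⟨ cong (λ s → -₃ s *₃ (M zero (inject₁ a) *₃ det₃ (suc m) (minor M (inject₁ a)))) sign-inject₁ ⟨
    -₃ sign₃ (toℕ (inject₁ a)) *₃ (M zero (inject₁ a) *₃ det₃ (suc m) (minor M (inject₁ a)))
      ≡⟨ neg-*ˡ (sign₃ (toℕ (inject₁ a))) _ ⟩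
    -₃ cofactorTerm (det₃ (suc m)) M (inject₁ a)
      ≡⟨ cong (λ k → -₃ cofactorTerm (det₃ (suc m)) M k) (swapWithNext-suc a) ⟨
    -₃ cofactorTerm (det₃ (suc m)) M (swapWithNext a (suc a))  ∎
  ... | away a′ fixed commute = begin
    sign₃ (toℕ j) *₃ (M′ zero j *₃ det₃ (suc m) (minor M′ j))
      ≡⟨ cong₂ (λ k d → sign₃ (toℕ j) *₃ (M zero k *₃ d)) fixed
           (trans (det₃-cong (suc m) (λ r c → cong (M (suc r)) (commute c)))
                  (det₃-swapWithNext m a′ (minor M j))) ⟩
    sign₃ (toℕ j) *₃ (M zero j *₃ -₃ det₃ (suc m) (minor M j))
      ≡⟨ neg-inside (sign₃ (toℕ j)) (M zero j) _ ⟩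
    -₃ cofactorTerm (det₃ (suc m)) M j
      ≡⟨ cong (λ k → -₃ cofactorTerm (det₃ (suc m)) M k) fixed ⟨
    -₃ cofactorTerm (det₃ (suc m)) M (swapWithNext a j)  ∎

swapWithNext-below : ∀ {n} (a : Fin n) c → toℕ c ℕ.< toℕ a → swapWithNext a c ≡ c
swapWithNext-below (suc a) zero    _   = refl
swapWithNext-below (suc a) (suc c) c<a = cong suc (swapWithNext-below a c (ℕ.≤-pred c<a))

det₃-equal-adjacent-columns : ∀ n (a : Fin n) (M : Matrix₃ (suc n)) →
  (∀ r → M r (inject₁ a) ≡ M r (suc a)) → det₃ (suc n) M ≡ 0₃
det₃-equal-adjacent-columns (suc m) a M equal =
  a≡-a⇒a≡0 _ (trans (det₃-cong (suc (suc m)) swap-invariant) (det₃-swapWithNext (suc m) a M))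
  where
  swap-invariant : ∀ r c → M r c ≡ M r (swapWithNext a c)
  swap-invariant r c with swapView a c
  ... | left           = trans (equal r) (cong (M r) (sym (swapWithNext-inject₁ a)))
  ... | right          = trans (sym (equal r)) (cong (M r) (sym (swapWithNext-suc a)))
  ... | away _ fixed _ = cong (M r) (sym fixed)

-- Induction on k = toℕ b: swapping columns b and b + 1 moves the second copy of
-- column p one step to the left.
det₃-equal-columns-below : ∀ k n (M : Matrix₃ (suc n)) p (b : Fin n) → toℕ b ≡ k → toℕ p ℕ.≤ k →
  (∀ r → M r p ≡ M r (suc b)) → det₃ (suc n) M ≡ 0₃
det₃-equal-columns-below k n M p b b≡k p≤k equal with toℕ p ℕ.≟ k
... | yes p≡k = det₃-equal-adjacent-columns n b M (λ r → trans (cong (M r) (sym p≡inject₁b)) (equal r))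
  where
  p≡inject₁b : p ≡ inject₁ b
  p≡inject₁b = Fin.toℕ-injective (trans p≡k (trans (sym b≡k) (sym (Fin.toℕ-inject₁ b))))
det₃-equal-columns-below zero    n       M p b       b≡k p≤k equal | no p≢k = ⊥-elim (p≢k (ℕ.n≤0⇒n≡0 p≤k))
det₃-equal-columns-below (suc k) (suc n) M p (suc b) b≡k p≤k equal | no p≢k =
  trans (sym (-₃-involutive _)) (cong -₃_ -det≡0)
  where
  p<k : toℕ p ℕ.< suc k
  p<k = ℕ.≤∧≢⇒< p≤k p≢k
  M′ : Matrix₃ (suc (suc n))
  M′ r c = M r (swapWithNext (suc b) c)
  -det≡0 : -₃ det₃ (suc (suc n)) M ≡ 0₃
  -det≡0 = trans (sym (det₃-swapWithNext (suc n) (suc b) M))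
    (det₃-equal-columns-below k (suc n) M′ p (inject₁ b) (trans (Fin.toℕ-inject₁ b) (ℕ.suc-injective b≡k)) (ℕ.≤-pred p<k)
      (λ r → trans (cong (M r) (swapWithNext-below (suc b) p (subst (toℕ p ℕ.<_) (sym b≡k) p<k)))
               (trans (equal r) (cong (M r) (sym (swapWithNext-inject₁ (suc b)))))))

det₃-equal-columns-< : ∀ n (M : Matrix₃ n) p q → toℕ p ℕ.< toℕ q → (∀ r → M r p ≡ M r q) → det₃ n M ≡ 0₃
det₃-equal-columns-< (suc n) M p (suc b) p<q equal =
  det₃-equal-columns-below (toℕ b) n M p b refl (ℕ.≤-pred p<q) equal

det₃-equal-columns : ∀ n (M : Matrix₃ n) p q → p ≢ q → (∀ r → M r p ≡ M r q) → det₃ n M ≡ 0₃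
det₃-equal-columns n M p q p≢q equal with ℕ.<-cmp (toℕ p) (toℕ q)
... | tri< p<q _ _ = det₃-equal-columns-< n M p q p<q equal
... | tri≈ _ p≡q _ = ⊥-elim (p≢q (Fin.toℕ-injective p≡q))
... | tri> _ _ q<p = det₃-equal-columns-< n M q p q<p (λ r → sym (equal r))

setColumn : ∀ {n} → Matrix₃ n → Fin n → (Fin n → F₃) → Matrix₃ n
setColumn M t u r j with j Fin.≟ t
... | yes _ = u r
... | no  _ = M r j

setColumn-≡ : ∀ {n} (M : Matrix₃ n) t u r → setColumn M t u r t ≡ u r
setColumn-≡ M t u r with t Fin.≟ t
... | yes _   = refl
... | no t≢t  = ⊥-elim (t≢t refl)

setColumn-≢ : ∀ {n} (M : Matrix₃ n) t u r j → j ≢ t → setColumn M t u r j ≡ M r j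
setColumn-≢ M t u r j j≢t with j Fin.≟ t
... | yes j≡t = ⊥-elim (j≢t j≡t)
... | no  _   = refl

setColumn-cong : ∀ {n} (M : Matrix₃ n) t {u v} → (∀ r → u r ≡ v r) → ∀ r j → setColumn M t u r j ≡ setColumn M t v r j
setColumn-cong M t u≡v r j with j Fin.≟ t
... | yes _ = u≡v r
... | no  _ = refl

setColumn-self : ∀ {n} (M : Matrix₃ n) t r j → setColumn M t (λ r → M r t) r j ≡ M r j
setColumn-self M t r j with j Fin.≟ t
... | yes refl = refl
... | no  _    = refl

det₃-setColumn-linear : ∀ n (M : Matrix₃ n) t u v β →
  det₃ n (setColumn M t (λ r → u r +₃ β *₃ v r)) ≡ det₃ n (setColumn M t u) +₃ β *₃ det₃ n (setColumn M t v)
det₃-setColumn-linear n M t u v β = det₃-linear n _ _ _ t β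
  (λ r j j≢t → trans (setColumn-≢ M t _ r j j≢t) (sym (setColumn-≢ M t u r j j≢t)))
  (λ r j j≢t → trans (setColumn-≢ M t v r j j≢t) (sym (setColumn-≢ M t u r j j≢t)))
  (λ r → trans (setColumn-≡ M t _ r)
           (sym (cong₂ (λ a b → a +₃ β *₃ b) (setColumn-≡ M t u r) (setColumn-≡ M t v r))))

det₃-setColumn-sum : ∀ n m (M : Matrix₃ n) t u (V : Fin m → Fin n → F₃) (β : Fin m → F₃) →
  det₃ n (setColumn M t (λ r → u r +₃ sum (λ k → β k *₃ V k r))) ≡
  det₃ n (setColumn M t u) +₃ sum (λ k → β k *₃ det₃ n (setColumn M t (V k)))
det₃-setColumn-sum n zero M t u V β =
  trans (det₃-cong n (setColumn-cong M t (λ r → +₃-identityʳ (u r)))) (sym (+₃-identityʳ _))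
det₃-setColumn-sum n (suc m) M t u V β = begin
  det₃ n (setColumn M t (λ r → u r +₃ (β zero *₃ V zero r +₃ rest r)))
    ≡⟨ det₃-cong n (setColumn-cong M t (λ r → move-last (u r) (β zero *₃ V zero r) (rest r))) ⟩
  det₃ n (setColumn M t (λ r → (u r +₃ rest r) +₃ β zero *₃ V zero r))
    ≡⟨ det₃-setColumn-linear n M t (λ r → u r +₃ rest r) (V zero) (β zero) ⟩
  det₃ n (setColumn M t (λ r → u r +₃ rest r)) +₃ β zero *₃ det₃ n (setColumn M t (V zero))
    ≡⟨ cong (_+₃ β zero *₃ det₃ n (setColumn M t (V zero))) (det₃-setColumn-sum n m M t u (λ k → V (suc k)) (λ k → β (suc k))) ⟩
  det₃ n (setColumn M t u) +₃ sum (λ k → β (suc k) *₃ det₃ n (setColumn M t (V (suc k)))) +₃ β zero *₃ det₃ n (setColumn M t (V zero))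
    ≡⟨ move-last (det₃ n (setColumn M t u)) _ _ ⟨
  det₃ n (setColumn M t u) +₃ sum (λ k → β k *₃ det₃ n (setColumn M t (V k)))  ∎
  where
  open ≡-Reasoning
  rest : Fin n → F₃
  rest r = sum (λ k → β (suc k) *₃ V (suc k) r)
  move-last : ∀ a b c → a +₃ (b +₃ c) ≡ a +₃ c +₃ b
  move-last = solve-∀ F₃-ring

det₃-add-column-combination : ∀ n (M : Matrix₃ n) t (β : Fin n → F₃) → β t ≡ 0₃ →
  det₃ n (setColumn M t (λ r → M r t +₃ sum (λ k → β k *₃ M r k))) ≡ det₃ n M
det₃-add-column-combination n M t β βt≡0 = begin
  det₃ n (setColumn M t (λ r → M r t +₃ sum (λ k → β k *₃ M r k)))
    ≡⟨ det₃-setColumn-sum n n M t (λ r → M r t) (λ k r → M r k) β ⟩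
  det₃ n (setColumn M t (λ r → M r t)) +₃ sum (λ k → β k *₃ det₃ n (setColumn M t (λ r → M r k)))
    ≡⟨ cong₂ _+₃_ (det₃-cong n (setColumn-self M t)) (sum-cong-≗ vanish) ⟩
  det₃ n M +₃ sum {n} (λ _ → 0₃)
    ≡⟨ cong (det₃ n M +₃_) (sum-replicate-zero n) ⟩
  det₃ n M +₃ 0₃
    ≡⟨ +₃-identityʳ (det₃ n M) ⟩
  det₃ n M  ∎
  where
  open ≡-Reasoning
  vanish : ∀ k → β k *₃ det₃ n (setColumn M t (λ r → M r k)) ≡ 0₃
  vanish k with k Fin.≟ t
  ... | yes refl = cong (_*₃ det₃ n (setColumn M k (λ r → M r k))) βt≡0
  ... | no k≢t   = trans (cong (β k *₃_) (det₃-equal-columns n _ k t k≢t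
                     (λ r → trans (setColumn-≢ M t _ r k k≢t) (sym (setColumn-≡ M t _ r)))))
                     (*₃-zeroʳ (β k))

sum-isolate : ∀ {n} t (f g : Fin n → F₃) → g t ≡ 0₃ → (∀ k → k ≢ t → g k ≡ f k) → sum f ≡ f t +₃ sum g
sum-isolate {suc n} t f g gt≡0 g≡f = begin
  sum f
    ≡⟨ sum-remove {i = t} f ⟩
  f t +₃ sum (λ c → f (punchIn t c))
    ≡⟨ cong (f t +₃_) (sum-cong-≗ (λ c → sym (g≡f (punchIn t c) (Fin.punchInᵢ≢i t c)))) ⟩
  f t +₃ sum (λ c → g (punchIn t c))
    ≡⟨ cong (λ a → f t +₃ (a +₃ sum (λ c → g (punchIn t c)))) gt≡0 ⟨
  f t +₃ (g t +₃ sum (λ c → g (punchIn t c))) ≡⟨ cong (f t +₃_) (sum-remove {i = t} g) ⟨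
  f t +₃ sum g  ∎
  where open ≡-Reasoning

infixl 7 _·₃_
_·₃_ : ∀ {n} → Matrix₃ n → Matrix₃ n → Matrix₃ n
(A ·₃ B) r j = sum (λ k → A r k *₃ B k j)

mixColumns : ∀ {n} → Matrix₃ n → Matrix₃ n → ℕ → Matrix₃ n
mixColumns A B s r j with toℕ j ℕ.<? s
... | yes _ = A r j
... | no  _ = (A ·₃ B) r j

module _ {n} (A B : Matrix₃ n) (B-diagonal : ∀ k → B k k ≡ 1₃) (B-upper : ∀ k j → j Fin.< k → B k j ≡ 0₃) where

  -- By unitriangularity, column s of A · B is column s of A plus ∑_{k<s} B k s · (column k
  -- of A), and the columns k < s of mixColumns A B (suc s) are already those of A.
  det₃-mixColumns-suc : ∀ s (t : Fin n) → toℕ t ≡ s → det₃ n (mixColumns A B s) ≡ det₃ n (mixColumns A B (suc s))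
  det₃-mixColumns-suc s t t≡s =
    trans (det₃-cong n column-operation) (det₃-add-column-combination n M t β βt≡0)
    where
    M : Matrix₃ n
    M = mixColumns A B (suc s)
    β : Fin n → F₃
    β k with toℕ k ℕ.<? s
    ... | yes _ = B k t
    ... | no  _ = 0₃
    βt≡0 : β t ≡ 0₃
    βt≡0 with toℕ t ℕ.<? s
    ... | yes t<s = ⊥-elim (ℕ.<-irrefl t≡s t<s)
    ... | no  _   = refl
    Mt≡A : ∀ r → M r t ≡ A r t
    Mt≡A r with toℕ t ℕ.<? suc s
    ... | yes _    = refl
    ... | no  t≮1+s = ⊥-elim (t≮1+s (subst (ℕ._< suc s) (sym t≡s) (ℕ.n<1+n s)))
    combination : ∀ r k → k ≢ t → β k *₃ M r k ≡ A r k *₃ B k t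
    combination r k k≢t with toℕ k ℕ.<? s | toℕ k ℕ.<? suc s
    ... | yes _   | yes _    = *₃-comm (B k t) (A r k)
    ... | yes k<s | no  k≮1+s = ⊥-elim (k≮1+s (ℕ.m<n⇒m<1+n k<s))
    ... | no  k≮s | _        = sym (trans (cong (A r k *₃_) (B-upper k t t<k)) (*₃-zeroʳ (A r k)))
      where
      t<k : t Fin.< k
      t<k = subst (ℕ._< toℕ k) (sym t≡s)
              (ℕ.≤∧≢⇒< (ℕ.≮⇒≥ k≮s) (λ s≡k → k≢t (Fin.toℕ-injective (trans (sym s≡k) (sym t≡s)))))
    column-operation : ∀ r j → mixColumns A B s r j ≡ setColumn M t (λ r → M r t +₃ sum (λ k → β k *₃ M r k)) r j
    column-operation r j with j Fin.≟ t
    column-operation r j | yes refl with toℕ j ℕ.<? s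
    ... | yes j<s = ⊥-elim (ℕ.<-irrefl t≡s j<s)
    ... | no  _   = begin
      sum (λ k → A r k *₃ B k j)
        ≡⟨ sum-isolate j _ _ (cong (_*₃ M r j) βt≡0) (combination r) ⟩
      A r j *₃ B j j +₃ sum (λ k → β k *₃ M r k)
        ≡⟨ cong (λ a → a +₃ sum (λ k → β k *₃ M r k))
                (trans (cong (A r j *₃_) (B-diagonal j)) (trans (*₃-identityʳ (A r j)) (sym (Mt≡A r)))) ⟩
      M r j +₃ sum (λ k → β k *₃ M r k)  ∎
      where open ≡-Reasoning
    column-operation r j | no j≢t with toℕ j ℕ.<? s | toℕ j ℕ.<? suc s
    ... | yes _   | yes _     = refl
    ... | yes j<s | no  j≮1+s = ⊥-elim (j≮1+s (ℕ.m<n⇒m<1+n j<s))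
    ... | no  j≮s | yes j<1+s =
      ⊥-elim (j≢t (Fin.toℕ-injective (trans (ℕ.≤-antisym (ℕ.≤-pred j<1+s) (ℕ.≮⇒≥ j≮s)) (sym t≡s))))
    ... | no  _   | no  _     = refl

  det₃-mixColumns : ∀ d s → s ℕ.+ d ≡ n → det₃ n (mixColumns A B s) ≡ det₃ n A
  det₃-mixColumns zero    s s+0≡n = det₃-cong n all-from-A
    where
    all-from-A : ∀ r j → mixColumns A B s r j ≡ A r j
    all-from-A r j with toℕ j ℕ.<? s
    ... | yes _   = refl
    ... | no  j≮s = ⊥-elim (j≮s (subst (toℕ j ℕ.<_) (trans (sym s+0≡n) (ℕ.+-identityʳ s)) (Fin.toℕ<n j)))
  det₃-mixColumns (suc d) s s+1+d≡n =
    trans (det₃-mixColumns-suc s (Fin.fromℕ< s<n) (Fin.toℕ-fromℕ< s<n))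
          (det₃-mixColumns d (suc s) (trans (sym (ℕ.+-suc s d)) s+1+d≡n))
    where
    s<n : s ℕ.< n
    s<n = subst (s ℕ.<_) s+1+d≡n (ℕ.m<m+n s ℕ.z<s)

  det₃-·-upperUnitriangular : det₃ n (A ·₃ B) ≡ det₃ n A
  det₃-·-upperUnitriangular = det₃-mixColumns n 0 refl

det₃-lowerTriangular : ∀ n (A : Matrix₃ n) → (∀ r c → r Fin.< c → A r c ≡ 0₃) → det₃ n A ≡ product (λ k → A k k)
det₃-lowerTriangular zero    A lower = refl
det₃-lowerTriangular (suc n) A lower = begin
  A zero zero *₃ det₃ n (minor A zero) +₃ sum (λ j → cofactorTerm (det₃ n) A (suc j))
    ≡⟨ cong₂ _+₃_ (cong (A zero zero *₃_) (det₃-lowerTriangular n _ (λ r c r<c → lower (suc r) (suc c) (ℕ.s<s r<c))))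
                  (sum-cong-≗ upper-right-zero) ⟩
  product (λ k → A k k) +₃ sum {n} (λ _ → 0₃)
    ≡⟨ cong (product (λ k → A k k) +₃_) (sum-replicate-zero n) ⟩
  product (λ k → A k k) +₃ 0₃
    ≡⟨ +₃-identityʳ _ ⟩
  product (λ k → A k k)  ∎
  where
  open ≡-Reasoning
  upper-right-zero : ∀ j → cofactorTerm (det₃ n) A (suc j) ≡ 0₃
  upper-right-zero j = begin
    sign₃ (toℕ (suc j)) *₃ (A zero (suc j) *₃ det₃ n (minor A (suc j)))
      ≡⟨ cong (λ a → sign₃ (toℕ (suc j)) *₃ (a *₃ det₃ n (minor A (suc j)))) (lower zero (suc j) ℕ.z<s) ⟩
    sign₃ (toℕ (suc j)) *₃ 0₃
      ≡⟨ *₃-zeroʳ _ ⟩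
    0₃  ∎

product-nonzero : ∀ {n} (f : Fin n → F₃) → (∀ k → f k ≢ 0₃) → product f ≢ 0₃
product-nonzero {zero}  f nonzero ()
product-nonzero {suc n} f nonzero = *₃-nonzero _ _ (nonzero zero) (product-nonzero (f ∘ suc) (nonzero ∘ suc))

-- Hankel determinants of Stieltjes tableaux

sumTo : ℕ → (ℕ → F₃) → F₃
sumTo zero    f = 0₃
sumTo (suc N) f = sumTo N f +₃ f N

sum-toℕ : ∀ n (f : ℕ → F₃) → sum (λ (k : Fin n) → f (toℕ k)) ≡ sumTo n f
sum-toℕ zero    f = refl
sum-toℕ (suc n) f = trans (cong (f 0 +₃_) (sum-toℕ n (f ∘ suc))) (sumTo-head n f)
  where
  sumTo-head : ∀ n f → f 0 +₃ sumTo n (f ∘ suc) ≡ sumTo (suc n) f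
  sumTo-head zero    f = +₃-identityʳ (f 0)
  sumTo-head (suc n) f = trans (sym (+₃-assoc (f 0) _ (f (suc n)))) (cong (_+₃ f (suc n)) (sumTo-head n f))

-- The Stieltjes tableau of the J-fraction 1/(1 - b₀x - Λ₁x²/(1 - b₁x - Λ₂x²/(1 - …))),
-- whose coefficients are l n 0.
module StieltjesTableau
  (l : ℕ → ℕ → F₃) (b Λ : ℕ → F₃)
  (l-origin : l 0 0 ≡ 1₃)
  (l-top    : ∀ k → l 0 (suc k) ≡ 0₃)
  (l-step₀  : ∀ n → l (suc n) 0 ≡ b 0 *₃ l n 0 +₃ Λ 1 *₃ l n 1)
  (l-step   : ∀ n k → l (suc n) (suc k) ≡ l n k +₃ b (suc k) *₃ l n (suc k) +₃ Λ (2 ℕ.+ k) *₃ l n (2 ℕ.+ k))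
  where

  weight : ℕ → F₃
  weight zero    = 1₃
  weight (suc k) = Λ (suc k) *₃ weight k

  weight-nonzero : (∀ k → Λ (suc k) ≢ 0₃) → ∀ k → weight k ≢ 0₃
  weight-nonzero Λ≢0 zero    = λ ()
  weight-nonzero Λ≢0 (suc k) = *₃-nonzero _ _ (Λ≢0 k) (weight-nonzero Λ≢0 k)

  l-above : ∀ n k → n ℕ.< k → l n k ≡ 0₃
  l-above zero    (suc k) _   = l-top k
  l-above (suc n) (suc k) n<k = begin
    l (suc n) (suc k)
      ≡⟨ l-step n k ⟩
    l n k +₃ b (suc k) *₃ l n (suc k) +₃ Λ (2 ℕ.+ k) *₃ l n (2 ℕ.+ k)
      ≡⟨ cong₂ (λ x y → x +₃ b (suc k) *₃ y +₃ Λ (2 ℕ.+ k) *₃ l n (2 ℕ.+ k)) (l-above n k n<k′) (l-above n (suc k) (ℕ.m<n⇒m<1+n n<k′)) ⟩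
    0₃ +₃ b (suc k) *₃ 0₃ +₃ Λ (2 ℕ.+ k) *₃ l n (2 ℕ.+ k)
      ≡⟨ cong (λ z → 0₃ +₃ b (suc k) *₃ 0₃ +₃ Λ (2 ℕ.+ k) *₃ z) (l-above n (2 ℕ.+ k) (ℕ.m<n⇒m<1+n (ℕ.m<n⇒m<1+n n<k′))) ⟩
    0₃ +₃ b (suc k) *₃ 0₃ +₃ Λ (2 ℕ.+ k) *₃ 0₃
      ≡⟨ vanish (b (suc k)) (Λ (2 ℕ.+ k)) ⟩
    0₃  ∎
    where
    open ≡-Reasoning
    n<k′ : n ℕ.< k
    n<k′ = ℕ.s<s⁻¹ n<k
    vanish : ∀ x y → 0₃ +₃ x *₃ 0₃ +₃ y *₃ 0₃ ≡ 0₃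
    vanish = solve-∀ F₃-ring

  l-diagonal : ∀ n → l n n ≡ 1₃
  l-diagonal zero    = l-origin
  l-diagonal (suc n) = begin
    l (suc n) (suc n)
      ≡⟨ l-step n n ⟩
    l n n +₃ b (suc n) *₃ l n (suc n) +₃ Λ (2 ℕ.+ n) *₃ l n (2 ℕ.+ n)
      ≡⟨ cong₂ (λ x y → x +₃ b (suc n) *₃ y +₃ Λ (2 ℕ.+ n) *₃ l n (2 ℕ.+ n)) (l-diagonal n) (l-above n (suc n) (ℕ.n<1+n n)) ⟩
    1₃ +₃ b (suc n) *₃ 0₃ +₃ Λ (2 ℕ.+ n) *₃ l n (2 ℕ.+ n)
      ≡⟨ cong (λ z → 1₃ +₃ b (suc n) *₃ 0₃ +₃ Λ (2 ℕ.+ n) *₃ z) (l-above n (2 ℕ.+ n) (ℕ.m<n⇒m<1+n (ℕ.n<1+n n))) ⟩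
    1₃ +₃ b (suc n) *₃ 0₃ +₃ Λ (2 ℕ.+ n) *₃ 0₃
      ≡⟨ vanish (b (suc n)) (Λ (2 ℕ.+ n)) ⟩
    1₃  ∎
    where
    open ≡-Reasoning
    vanish : ∀ x y → 1₃ +₃ x *₃ 0₃ +₃ y *₃ 0₃ ≡ 1₃
    vanish = solve-∀ F₃-ring

  pairing : ℕ → ℕ → ℕ → F₃
  pairing N i j = sumTo N (λ k → l i k *₃ l j k *₃ weight k)

  boundary : ℕ → ℕ → ℕ → F₃
  boundary zero    i j = 0₃
  boundary (suc N) i j = weight (suc N) *₃ (l i (suc N) *₃ l j N +₃ -₃ (l i N *₃ l j (suc N)))

  boundary-step : ∀ N i j →
    boundary N i j +₃ l (suc i) N *₃ l j N *₃ weight N ≡ l i N *₃ l (suc j) N *₃ weight N +₃ boundary (suc N) i j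
  boundary-step zero i j = begin
    0₃ +₃ l (suc i) 0 *₃ l j 0 *₃ 1₃
      ≡⟨ cong (λ z → 0₃ +₃ z *₃ l j 0 *₃ 1₃) (l-step₀ i) ⟩
    0₃ +₃ (b 0 *₃ l i 0 +₃ Λ 1 *₃ l i 1) *₃ l j 0 *₃ 1₃
      ≡⟨ telescope (b 0) (Λ 1) (l i 0) (l i 1) (l j 0) (l j 1) ⟩
    l i 0 *₃ (b 0 *₃ l j 0 +₃ Λ 1 *₃ l j 1) *₃ 1₃ +₃ boundary 1 i j
      ≡⟨ cong (λ z → l i 0 *₃ z *₃ 1₃ +₃ boundary 1 i j) (l-step₀ j) ⟨
    l i 0 *₃ l (suc j) 0 *₃ 1₃ +₃ boundary 1 i j  ∎
    where
    open ≡-Reasoning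
    telescope : ∀ β λ₁ x₀ x₁ y₀ y₁ →
      0₃ +₃ (β *₃ x₀ +₃ λ₁ *₃ x₁) *₃ y₀ *₃ 1₃ ≡
      x₀ *₃ (β *₃ y₀ +₃ λ₁ *₃ y₁) *₃ 1₃ +₃ (λ₁ *₃ 1₃) *₃ (x₁ *₃ y₀ +₃ -₃ (x₀ *₃ y₁))
    telescope = solve-∀ F₃-ring
  boundary-step (suc k) i j = begin
    boundary (suc k) i j +₃ l (suc i) (suc k) *₃ l j (suc k) *₃ weight (suc k)
      ≡⟨ cong (λ z → boundary (suc k) i j +₃ z *₃ l j (suc k) *₃ weight (suc k)) (l-step i k) ⟩
    boundary (suc k) i j +₃ (l i k +₃ b (suc k) *₃ l i (suc k) +₃ Λ (2 ℕ.+ k) *₃ l i (2 ℕ.+ k)) *₃ l j (suc k) *₃ weight (suc k)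
      ≡⟨ telescope (weight (suc k)) (b (suc k)) (Λ (2 ℕ.+ k)) (l i k) (l i (suc k)) (l i (2 ℕ.+ k)) (l j k) (l j (suc k)) (l j (2 ℕ.+ k)) ⟩
    l i (suc k) *₃ (l j k +₃ b (suc k) *₃ l j (suc k) +₃ Λ (2 ℕ.+ k) *₃ l j (2 ℕ.+ k)) *₃ weight (suc k) +₃ boundary (2 ℕ.+ k) i j
      ≡⟨ cong (λ z → l i (suc k) *₃ z *₃ weight (suc k) +₃ boundary (2 ℕ.+ k) i j) (l-step j k) ⟨
    l i (suc k) *₃ l (suc j) (suc k) *₃ weight (suc k) +₃ boundary (2 ℕ.+ k) i j  ∎
    where
    open ≡-Reasoning
    telescope : ∀ w β λ₂ x₀ x₁ x₂ y₀ y₁ y₂ →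
      w *₃ (x₁ *₃ y₀ +₃ -₃ (x₀ *₃ y₁)) +₃ (x₀ +₃ β *₃ x₁ +₃ λ₂ *₃ x₂) *₃ y₁ *₃ w ≡
      x₁ *₃ (y₀ +₃ β *₃ y₁ +₃ λ₂ *₃ y₂) *₃ w +₃ (λ₂ *₃ w) *₃ (x₂ *₃ y₁ +₃ -₃ (x₁ *₃ y₂))
    telescope = solve-∀ F₃-ring

  pairing-suc-left : ∀ N i j → pairing N (suc i) j ≡ pairing N i (suc j) +₃ boundary N i j
  pairing-suc-left zero    i j = refl
  pairing-suc-left (suc N) i j = begin
    pairing N (suc i) j +₃ l (suc i) N *₃ l j N *₃ weight N
      ≡⟨ cong (_+₃ l (suc i) N *₃ l j N *₃ weight N) (pairing-suc-left N i j) ⟩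
    pairing N i (suc j) +₃ boundary N i j +₃ l (suc i) N *₃ l j N *₃ weight N
      ≡⟨ +₃-assoc (pairing N i (suc j)) _ _ ⟩
    pairing N i (suc j) +₃ (boundary N i j +₃ l (suc i) N *₃ l j N *₃ weight N)
      ≡⟨ cong (pairing N i (suc j) +₃_) (boundary-step N i j) ⟩
    pairing N i (suc j) +₃ (l i N *₃ l (suc j) N *₃ weight N +₃ boundary (suc N) i j)
      ≡⟨ +₃-assoc (pairing N i (suc j)) _ _ ⟨
    pairing (suc N) i (suc j) +₃ boundary (suc N) i j  ∎
    where open ≡-Reasoning

  boundary-vanishes : ∀ N i j → i ℕ.< N → j ℕ.< N → boundary N i j ≡ 0₃
  boundary-vanishes (suc N) i j i<N j<N =
    trans (cong₂ (λ x y → weight (suc N) *₃ (x *₃ l j N +₃ -₃ (l i N *₃ y))) (l-above i (suc N) i<N) (l-above j (suc N) j<N))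
          (vanish (weight (suc N)) (l j N) (l i N))
    where
    vanish : ∀ w y x → w *₃ (0₃ *₃ y +₃ -₃ (x *₃ 0₃)) ≡ 0₃
    vanish = solve-∀ F₃-ring

  pairing-origin : ∀ N j → pairing (suc N) 0 j ≡ l j 0
  pairing-origin zero    j = trans (cong (λ z → z *₃ l j 0 *₃ 1₃) l-origin) (*₃-identityʳ (l j 0))
  pairing-origin (suc N) j =
    trans (cong (λ z → pairing (suc N) 0 j +₃ z *₃ l j (suc N) *₃ weight (suc N)) (l-top N))
          (trans (+₃-identityʳ _) (pairing-origin N j))

  pairing-hankel : ∀ N i j → i ℕ.+ j ℕ.< N → pairing N i j ≡ l (i ℕ.+ j) 0
  pairing-hankel (suc N) zero    j i+j<N = pairing-origin N j
  pairing-hankel N       (suc i) j i+j<N = begin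
    pairing N (suc i) j
      ≡⟨ pairing-suc-left N i j ⟩
    pairing N i (suc j) +₃ boundary N i j
      ≡⟨ cong (pairing N i (suc j) +₃_) (boundary-vanishes N i j i<N j<N) ⟩
    pairing N i (suc j) +₃ 0₃
      ≡⟨ +₃-identityʳ _ ⟩
    pairing N i (suc j)
      ≡⟨ pairing-hankel N i (suc j) (subst (ℕ._< N) (sym (ℕ.+-suc i j)) i+j<N) ⟩
    l (i ℕ.+ suc j) 0
      ≡⟨ cong (λ m → l m 0) (ℕ.+-suc i j) ⟩
    l (suc i ℕ.+ j) 0  ∎
    where
    open ≡-Reasoning
    i<N : i ℕ.< N
    i<N = ℕ.<-trans (ℕ.s≤s (ℕ.m≤m+n i j)) i+j<N
    j<N : j ℕ.< N
    j<N = ℕ.<-trans (ℕ.s≤s (ℕ.m≤n+m j i)) i+j<N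

  pairing-extend : ∀ N m i j → i ℕ.< N → pairing (N ℕ.+ m) i j ≡ pairing N i j
  pairing-extend N zero    i j i<N = cong (λ K → pairing K i j) (ℕ.+-identityʳ N)
  pairing-extend N (suc m) i j i<N = begin
    pairing (N ℕ.+ suc m) i j
      ≡⟨ cong (λ K → pairing K i j) (ℕ.+-suc N m) ⟩
    pairing (N ℕ.+ m) i j +₃ l i (N ℕ.+ m) *₃ l j (N ℕ.+ m) *₃ weight (N ℕ.+ m)
      ≡⟨ cong (λ z → pairing (N ℕ.+ m) i j +₃ z *₃ l j (N ℕ.+ m) *₃ weight (N ℕ.+ m))
              (l-above i (N ℕ.+ m) (ℕ.<-≤-trans i<N (ℕ.m≤m+n N m))) ⟩
    pairing (N ℕ.+ m) i j +₃ 0₃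
      ≡⟨ +₃-identityʳ _ ⟩
    pairing (N ℕ.+ m) i j
      ≡⟨ pairing-extend N m i j i<N ⟩
    pairing N i j  ∎
    where open ≡-Reasoning

  hankel-pairing : ∀ n i j → i ℕ.< n → j ℕ.< n → l (i ℕ.+ j) 0 ≡ pairing n i j
  hankel-pairing n i j i<n j<n = trans (sym (pairing-hankel (n ℕ.+ n) i j (ℕ.+-mono-< i<n j<n))) (pairing-extend n n i j i<n)

  -- H = (L·W)·Lᵀ with L = (l i k) lower unitriangular and W = diag(weight k).
  det₃-hankel : ∀ n → det₃ n (λ i j → l (toℕ i ℕ.+ toℕ j) 0) ≡ product {n} (λ k → weight (toℕ k))
  det₃-hankel n = begin
    det₃ n (λ i j → l (toℕ i ℕ.+ toℕ j) 0)
      ≡⟨ det₃-cong n factorisation ⟩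
    det₃ n (LW ·₃ Lᵀ)
      ≡⟨ det₃-·-upperUnitriangular LW Lᵀ (λ k → l-diagonal (toℕ k)) (λ k j → l-above (toℕ j) (toℕ k)) ⟩
    det₃ n LW
      ≡⟨ det₃-lowerTriangular n LW (λ r k r<k → cong (_*₃ weight (toℕ k)) (l-above (toℕ r) (toℕ k) r<k)) ⟩
    product (λ k → LW k k)
      ≡⟨ product-cong-≗ {x = λ k → LW k k} (λ k → cong (_*₃ weight (toℕ k)) (l-diagonal (toℕ k))) ⟩
    product {n} (λ k → weight (toℕ k))  ∎
    where
    open ≡-Reasoning
    LW Lᵀ : Matrix₃ n
    LW r k = l (toℕ r) (toℕ k) *₃ weight (toℕ k)
    Lᵀ k j = l (toℕ j) (toℕ k)
    factorisation : ∀ i j → l (toℕ i ℕ.+ toℕ j) 0 ≡ (LW ·₃ Lᵀ) i j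
    factorisation i j = begin
      l (toℕ i ℕ.+ toℕ j) 0
        ≡⟨ hankel-pairing n (toℕ i) (toℕ j) (Fin.toℕ<n i) (Fin.toℕ<n j) ⟩
      pairing n (toℕ i) (toℕ j)
        ≡⟨ sum-toℕ n (λ k → l (toℕ i) k *₃ l (toℕ j) k *₃ weight k) ⟨
      sum {n} (λ k → l (toℕ i) (toℕ k) *₃ l (toℕ j) (toℕ k) *₃ weight (toℕ k))
        ≡⟨ sum-cong-≗ {y = λ k → LW i k *₃ Lᵀ k j} (λ k → reorder (l (toℕ i) (toℕ k)) (l (toℕ j) (toℕ k)) (weight (toℕ k))) ⟩
      (LW ·₃ Lᵀ) i j  ∎
      where
      reorder : ∀ x y w → x *₃ y *₃ w ≡ x *₃ w *₃ y
      reorder = solve-∀ F₃-ring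

-- Power series over F₃

Series₃ : Set
Series₃ = ℕ → F₃

≗-refl : ∀ {A : Series₃} → A ≗ A
≗-refl n = refl

≗-sym : ∀ {A B : Series₃} → A ≗ B → B ≗ A
≗-sym A≗B n = sym (A≗B n)

≗-trans : ∀ {A B C : Series₃} → A ≗ B → B ≗ C → A ≗ C
≗-trans A≗B B≗C n = trans (A≗B n) (B≗C n)

infixl 6 _+ₛ_
infixl 7 _*ₛ_ _·ₛ_
infix 8 -ₛ_

const : F₃ → Series₃
const a zero    = a
const a (suc n) = 0₃

0ₛ 1ₛ : Series₃
0ₛ _ = 0₃
1ₛ = const 1₃

_+ₛ_ : Series₃ → Series₃ → Series₃
(A +ₛ B) n = A n +₃ B n

-ₛ_ : Series₃ → Series₃
(-ₛ A) n = -₃ A n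

_·ₛ_ : F₃ → Series₃ → Series₃
(a ·ₛ A) n = a *₃ A n

_*ₛ_ : Series₃ → Series₃ → Series₃
(A *ₛ B) zero    = A 0 *₃ B 0
(A *ₛ B) (suc n) = A 0 *₃ B (suc n) +₃ ((A ∘ suc) *ₛ B) n

shift : Series₃ → Series₃
shift A zero    = 0₃
shift A (suc n) = A n

X : Series₃
X = shift 1ₛ

shift-cong : ∀ {A B} → A ≗ B → shift A ≗ shift B
shift-cong A≗B zero    = refl
shift-cong A≗B (suc n) = A≗B n

+ₛ-cong : ∀ {A A′ B B′} → A ≗ A′ → B ≗ B′ → A +ₛ B ≗ A′ +ₛ B′
+ₛ-cong A≗A′ B≗B′ n = cong₂ _+₃_ (A≗A′ n) (B≗B′ n)

-ₛ-cong : ∀ {A A′} → A ≗ A′ → -ₛ A ≗ -ₛ A′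
-ₛ-cong A≗A′ n = cong -₃_ (A≗A′ n)

*ₛ-cong : ∀ {A A′ B B′} → A ≗ A′ → B ≗ B′ → A *ₛ B ≗ A′ *ₛ B′
*ₛ-cong A≗A′ B≗B′ zero    = cong₂ _*₃_ (A≗A′ 0) (B≗B′ 0)
*ₛ-cong A≗A′ B≗B′ (suc n) =
  cong₂ _+₃_ (cong₂ _*₃_ (A≗A′ 0) (B≗B′ (suc n)))
             (*ₛ-cong (A≗A′ ∘ suc) B≗B′ n)

*ₛ-unfold : ∀ A B → A *ₛ B ≗ A 0 ·ₛ B +ₛ shift ((A ∘ suc) *ₛ B)
*ₛ-unfold A B zero    = sym (+₃-identityʳ _)
*ₛ-unfold A B (suc n) = refl

shift-*ₛ : ∀ A B → shift A *ₛ B ≗ shift (A *ₛ B)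
shift-*ₛ A B zero    = refl
shift-*ₛ A B (suc n) = refl

·ₛ-*ₛ : ∀ a A B → (a ·ₛ A) *ₛ B ≗ a ·ₛ (A *ₛ B)
·ₛ-*ₛ a A B zero    = *₃-assoc a (A 0) (B 0)
·ₛ-*ₛ a A B (suc n) =
  trans (cong₂ _+₃_ (*₃-assoc a (A 0) (B (suc n))) (·ₛ-*ₛ a (A ∘ suc) B n))
        (sym (*₃-distribˡ-+₃ a _ _))

*ₛ-zeroˡ : ∀ B → 0ₛ *ₛ B ≗ 0ₛ
*ₛ-zeroˡ B zero    = refl
*ₛ-zeroˡ B (suc n) = *ₛ-zeroˡ B n

const-*ₛ : ∀ a B → const a *ₛ B ≗ a ·ₛ B
const-*ₛ a B zero    = refl
const-*ₛ a B (suc n) = trans (cong (a *₃ B (suc n) +₃_) (*ₛ-zeroˡ B n)) (+₃-identityʳ _)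

*ₛ-identityˡ : ∀ B → 1ₛ *ₛ B ≗ B
*ₛ-identityˡ B = ≗-trans (const-*ₛ 1₃ B) ≗-refl

*ₛ-distribʳ-+ₛ : ∀ C A B → (A +ₛ B) *ₛ C ≗ A *ₛ C +ₛ B *ₛ C
*ₛ-distribʳ-+ₛ C A B zero    = *₃-distribʳ-+₃ (C 0) (A 0) (B 0)
*ₛ-distribʳ-+ₛ C A B (suc n) =
  trans (cong₂ _+₃_ (*₃-distribʳ-+₃ (C (suc n)) (A 0) (B 0)) (*ₛ-distribʳ-+ₛ C (A ∘ suc) (B ∘ suc) n))
        (interchange (A 0 *₃ C (suc n)) (B 0 *₃ C (suc n)) (((A ∘ suc) *ₛ C) n) (((B ∘ suc) *ₛ C) n))
  where
  interchange : ∀ a b c d → a +₃ b +₃ (c +₃ d) ≡ a +₃ c +₃ (b +₃ d)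
  interchange = solve-∀ F₃-ring

*ₛ-distribˡ-+ₛ : ∀ A B C → A *ₛ (B +ₛ C) ≗ A *ₛ B +ₛ A *ₛ C
*ₛ-distribˡ-+ₛ A B C zero    = *₃-distribˡ-+₃ (A 0) (B 0) (C 0)
*ₛ-distribˡ-+ₛ A B C (suc n) =
  trans (cong₂ _+₃_ (*₃-distribˡ-+₃ (A 0) (B (suc n)) (C (suc n))) (*ₛ-distribˡ-+ₛ (A ∘ suc) B C n))
        (interchange (A 0 *₃ B (suc n)) (A 0 *₃ C (suc n)) (((A ∘ suc) *ₛ B) n) (((A ∘ suc) *ₛ C) n))
  where
  interchange : ∀ a b c d → a +₃ b +₃ (c +₃ d) ≡ a +₃ c +₃ (b +₃ d)
  interchange = solve-∀ F₃-ring

*ₛ-comm : ∀ A B → A *ₛ B ≗ B *ₛ A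
*ₛ-comm A B zero                = *₃-comm (A 0) (B 0)
*ₛ-comm A B (suc zero)          = begin
  A 0 *₃ B 1 +₃ A 1 *₃ B 0   ≡⟨ +₃-comm (A 0 *₃ B 1) (A 1 *₃ B 0) ⟩
  A 1 *₃ B 0 +₃ A 0 *₃ B 1   ≡⟨ cong₂ _+₃_ (*₃-comm (A 1) (B 0)) (*₃-comm (A 0) (B 1)) ⟩
  B 0 *₃ A 1 +₃ B 1 *₃ A 0   ∎
  where open ≡-Reasoning
*ₛ-comm A B (suc (suc n)) = begin
  A 0 *₃ B (2 ℕ.+ n) +₃ ((A ∘ suc) *ₛ B) (suc n)
    ≡⟨ cong (A 0 *₃ B (2 ℕ.+ n) +₃_) (*ₛ-comm (A ∘ suc) B (suc n)) ⟩
  A 0 *₃ B (2 ℕ.+ n) +₃ (B 0 *₃ A (2 ℕ.+ n) +₃ ((B ∘ suc) *ₛ (A ∘ suc)) n)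
    ≡⟨ cong (λ z → A 0 *₃ B (2 ℕ.+ n) +₃ (B 0 *₃ A (2 ℕ.+ n) +₃ z)) (*ₛ-comm (B ∘ suc) (A ∘ suc) n) ⟩
  A 0 *₃ B (2 ℕ.+ n) +₃ (B 0 *₃ A (2 ℕ.+ n) +₃ ((A ∘ suc) *ₛ (B ∘ suc)) n)
    ≡⟨ swap-front (A 0 *₃ B (2 ℕ.+ n)) (B 0 *₃ A (2 ℕ.+ n)) _ ⟩
  B 0 *₃ A (2 ℕ.+ n) +₃ (A 0 *₃ B (2 ℕ.+ n) +₃ ((A ∘ suc) *ₛ (B ∘ suc)) n)
    ≡⟨ cong (B 0 *₃ A (2 ℕ.+ n) +₃_) (*ₛ-comm A (B ∘ suc) (suc n)) ⟩
  B 0 *₃ A (2 ℕ.+ n) +₃ ((B ∘ suc) *ₛ A) (suc n)  ∎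
  where
  open ≡-Reasoning
  swap-front : ∀ x y z → x +₃ (y +₃ z) ≡ y +₃ (x +₃ z)
  swap-front = solve-∀ F₃-ring

*ₛ-assoc : ∀ A B C → (A *ₛ B) *ₛ C ≗ A *ₛ (B *ₛ C)
*ₛ-assoc A B C zero    = *₃-assoc (A 0) (B 0) (C 0)
*ₛ-assoc A B C (suc n) = begin
  ((A *ₛ B) *ₛ C) (suc n)
    ≡⟨ *ₛ-cong (*ₛ-unfold A B) ≗-refl (suc n) ⟩
  ((A 0 ·ₛ B +ₛ shift ((A ∘ suc) *ₛ B)) *ₛ C) (suc n)
    ≡⟨ *ₛ-distribʳ-+ₛ C (A 0 ·ₛ B) (shift ((A ∘ suc) *ₛ B)) (suc n) ⟩
  ((A 0 ·ₛ B) *ₛ C) (suc n) +₃ (shift ((A ∘ suc) *ₛ B) *ₛ C) (suc n)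
    ≡⟨ cong₂ _+₃_ (·ₛ-*ₛ (A 0) B C (suc n)) (shift-*ₛ ((A ∘ suc) *ₛ B) C (suc n)) ⟩
  A 0 *₃ (B *ₛ C) (suc n) +₃ (((A ∘ suc) *ₛ B) *ₛ C) n
    ≡⟨ cong (A 0 *₃ (B *ₛ C) (suc n) +₃_) (*ₛ-assoc (A ∘ suc) B C n) ⟩
  A 0 *₃ (B *ₛ C) (suc n) +₃ ((A ∘ suc) *ₛ (B *ₛ C)) n  ∎
  where open ≡-Reasoning

Series-commutativeRing : CommutativeRing _ _
Series-commutativeRing = record
  { Carrier = Series₃ ; _≈_ = _≗_ ; _+_ = _+ₛ_ ; _*_ = _*ₛ_ ; -_ = -ₛ_ ; 0# = 0ₛ ; 1# = 1ₛ
  ; isCommutativeRing = record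
    { isRing = record
      { +-isAbelianGroup = record
        { isGroup = record
          { isMonoid = record
            { isSemigroup = record
              { isMagma = record
                { isEquivalence = record { refl = λ {A} → ≗-refl {A} ; sym = ≗-sym ; trans = ≗-trans }
                ; ∙-cong = +ₛ-cong }
              ; assoc = λ A B C n → +₃-assoc (A n) (B n) (C n) }
            ; identity = (λ A → ≗-refl) , (λ A n → +₃-identityʳ (A n)) }
          ; inverse = (λ A n → -₃-inverseˡ (A n)) , (λ A n → -₃-inverseʳ (A n))
          ; ⁻¹-cong = -ₛ-cong }
        ; comm = λ A B n → +₃-comm (A n) (B n) }
      ; *-cong = *ₛ-cong
      ; *-assoc = *ₛ-assoc
      ; *-identity = *ₛ-identityˡ , (λ A → ≗-trans (*ₛ-comm A 1ₛ) (*ₛ-identityˡ A))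
      ; distrib = *ₛ-distribˡ-+ₛ , *ₛ-distribʳ-+ₛ }
    ; *-comm = *ₛ-comm } }

Series-almostCommutativeRing : Classical.AlmostCommutativeRing _ _
Series-almostCommutativeRing = Classical.fromCommutativeRing Series-commutativeRing

const-homomorphism : CommutativeRing.rawRing F₃-commutativeRing Classical.-Raw-AlmostCommutative⟶ Series-almostCommutativeRing
const-homomorphism = record
  { ⟦_⟧    = const
  ; +-homo = λ a b → λ { zero → refl ; (suc n) → refl }
  ; *-homo = λ a b → ≗-sym (≗-trans (const-*ₛ a (const b)) (λ { zero → refl ; (suc n) → *₃-zeroʳ a }))
  ; -‿homo = λ a → λ { zero → refl ; (suc n) → refl }
  ; 0-homo = λ { zero → refl ; (suc n) → refl }
  ; 1-homo = ≗-refl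
  }

const-≟ : ∀ a b → Maybe (const a ≗ const b)
const-≟ 0₃ 0₃ = just ≗-refl
const-≟ 1₃ 1₃ = just ≗-refl
const-≟ 2₃ 2₃ = just ≗-refl
const-≟ _  _  = nothing

module ≗-Reasoning = SetoidReasoning (CommutativeRing.setoid Series-commutativeRing)

module SeriesSolver = Algebra.Solver.Ring (CommutativeRing.rawRing F₃-commutativeRing)
  Series-almostCommutativeRing const-homomorphism const-≟

open SeriesSolver using (solve; _:=_; _:+_; _:*_; :-_; con)

-- The functional equation of f modulo 3

open SemiringExp (CommutativeRing.semiring Series-commutativeRing)
  renaming (_^_ to _^ₛ_) using (^-assocʳ; ^-congʳ)

cube : Series₃ → Series₃
cube A = A *ₛ A *ₛ A

X-*ₛ : ∀ B → X *ₛ B ≗ shift B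
X-*ₛ B = ≗-trans (shift-*ₛ 1ₛ B) (shift-cong (*ₛ-identityˡ B))

-- Multiplication by xᵈ, written like the shift inside mulFactor.
shiftBy : ℕ → Series₃ → Series₃
shiftBy d G i with d ≤? i
... | yes _ = G (i ∸ d)
... | no  _ = 0₃

shiftBy-zero : ∀ G → shiftBy 0 G ≗ G
shiftBy-zero G i = refl

shiftBy-suc : ∀ d G → shiftBy (suc d) G ≗ shift (shiftBy d G)
shiftBy-suc d G zero = refl
shiftBy-suc d G (suc i) with suc d ≤? suc i | d ≤? i
... | yes _     | yes _   = refl
... | yes 1+d≤1+i | no d≰i = ⊥-elim (d≰i (ℕ.s≤s⁻¹ 1+d≤1+i))
... | no 1+d≰1+i  | yes d≤i = ⊥-elim (1+d≰1+i (ℕ.s≤s d≤i))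
... | no  _     | no  _   = refl

shiftBy-below : ∀ d G i → i ℕ.< d → shiftBy d G i ≡ 0₃
shiftBy-below d G i i<d with d ≤? i
... | yes d≤i = ⊥-elim (ℕ.<⇒≱ i<d d≤i)
... | no  _   = refl

X^-*ₛ : ∀ m G → X ^ₛ m *ₛ G ≗ shiftBy m G
X^-*ₛ zero    G = ≗-trans (*ₛ-identityˡ G) (≗-sym (shiftBy-zero G))
X^-*ₛ (suc m) G = begin
  X *ₛ X ^ₛ m *ₛ G      ≈⟨ *ₛ-assoc X (X ^ₛ m) G ⟩
  X *ₛ (X ^ₛ m *ₛ G)    ≈⟨ X-*ₛ _ ⟩
  shift (X ^ₛ m *ₛ G)   ≈⟨ shift-cong (X^-*ₛ m G) ⟩
  shift (shiftBy m G)   ≈⟨ shiftBy-suc m G ⟨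
  shiftBy (suc m) G     ∎
  where open ≗-Reasoning

φ : ℕ → Series₃
φ m = 1ₛ +ₛ -ₛ X ^ₛ m +ₛ -ₛ X ^ₛ (2 ℕ.* m)

mod₃-mulFactor : ∀ m g i →
  mod₃ (mulFactor m g i) ≡ mod₃ (g i) +₃ -₃ shiftBy m (mod₃ ∘ g) i +₃ -₃ shiftBy (2 ℕ.* m) (mod₃ ∘ g) i
mod₃-mulFactor m g i with m ≤? i | 2 ℕ.* m ≤? i
... | yes _ | yes _ = mod₃-−− (g i) (g (i ∸ m)) (g (i ∸ 2 ℕ.* m))
... | yes _ | no  _ = mod₃-−− (g i) (g (i ∸ m)) 0ℤ
... | no  _ | yes _ = mod₃-−− (g i) 0ℤ (g (i ∸ 2 ℕ.* m))
... | no  _ | no  _ = mod₃-−− (g i) 0ℤ 0ℤ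

φ-*ₛ : ∀ m G → φ m *ₛ G ≗ G +ₛ -ₛ shiftBy m G +ₛ -ₛ shiftBy (2 ℕ.* m) G
φ-*ₛ m G = begin
  (1ₛ +ₛ -ₛ X ^ₛ m +ₛ -ₛ X ^ₛ (2 ℕ.* m)) *ₛ G
    ≈⟨ distribute (X ^ₛ m) (X ^ₛ (2 ℕ.* m)) G ⟩
  G +ₛ -ₛ (X ^ₛ m *ₛ G) +ₛ -ₛ (X ^ₛ (2 ℕ.* m) *ₛ G)
    ≈⟨ +ₛ-cong (+ₛ-cong ≗-refl (-ₛ-cong (X^-*ₛ m G))) (-ₛ-cong (X^-*ₛ (2 ℕ.* m) G)) ⟩
  G +ₛ -ₛ shiftBy m G +ₛ -ₛ shiftBy (2 ℕ.* m) G  ∎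
  where
  open ≗-Reasoning
  distribute : ∀ a b g → (1ₛ +ₛ -ₛ a +ₛ -ₛ b) *ₛ g ≗ g +ₛ -ₛ (a *ₛ g) +ₛ -ₛ (b *ₛ g)
  distribute = solve 3 (λ a b g → (con 1₃ :+ :- a :+ :- b) :* g := g :+ :- (a :* g) :+ :- (b :* g)) ≗-refl

partialProd₃ : ℕ → Series₃
partialProd₃ K i = mod₃ (partialProd K i)

partialProd₃-zero : partialProd₃ 0 ≗ 1ₛ
partialProd₃-zero zero    = refl
partialProd₃-zero (suc i) = refl

partialProd₃-suc : ∀ K → partialProd₃ (suc K) ≗ φ (3 ^ K) *ₛ partialProd₃ K
partialProd₃-suc K = ≗-trans (mod₃-mulFactor (3 ^ K) (partialProd K)) (≗-sym (φ-*ₛ (3 ^ K) (partialProd₃ K)))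

cube-cong : ∀ {A A′} → A ≗ A′ → cube A ≗ cube A′
cube-cong A≗A′ = *ₛ-cong (*ₛ-cong A≗A′ A≗A′) A≗A′

-- The solver normalises coefficients in F₃, where the binomial coefficients 3 vanish.
cube-1-a-b : ∀ a b → cube (1ₛ +ₛ -ₛ a +ₛ -ₛ b) ≗ 1ₛ +ₛ -ₛ cube a +ₛ -ₛ cube b
cube-1-a-b = solve 2 (λ a b → (con 1₃ :+ :- a :+ :- b) :* (con 1₃ :+ :- a :+ :- b) :* (con 1₃ :+ :- a :+ :- b)
                              := con 1₃ :+ :- (a :* a :* a) :+ :- (b :* b :* b)) ≗-refl

cube-X^ : ∀ m → cube (X ^ₛ m) ≗ X ^ₛ (3 ℕ.* m)
cube-X^ m = begin
  X ^ₛ m *ₛ X ^ₛ m *ₛ X ^ₛ m   ≈⟨ as-power (X ^ₛ m) ⟩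
  (X ^ₛ m) ^ₛ 3                ≈⟨ ^-assocʳ X m 3 ⟩
  X ^ₛ (m ℕ.* 3)               ≈⟨ ^-congʳ X (ℕ.*-comm m 3) ⟩
  X ^ₛ (3 ℕ.* m)               ∎
  where
  open ≗-Reasoning
  as-power : ∀ a → a *ₛ a *ₛ a ≗ a *ₛ (a *ₛ (a *ₛ 1ₛ))
  as-power = solve 1 (λ a → a :* a :* a := a :* (a :* (a :* con 1₃))) ≗-refl

φ-3* : ∀ m → φ (3 ℕ.* m) ≗ cube (φ m)
φ-3* m = begin
  1ₛ +ₛ -ₛ X ^ₛ (3 ℕ.* m) +ₛ -ₛ X ^ₛ (2 ℕ.* (3 ℕ.* m))
    ≈⟨ +ₛ-cong (+ₛ-cong ≗-refl (-ₛ-cong (≗-sym (cube-X^ m))))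
               (-ₛ-cong (≗-trans (^-congʳ X (2*3*m≡3*2*m)) (≗-sym (cube-X^ (2 ℕ.* m))))) ⟩
  1ₛ +ₛ -ₛ cube (X ^ₛ m) +ₛ -ₛ cube (X ^ₛ (2 ℕ.* m))
    ≈⟨ cube-1-a-b (X ^ₛ m) (X ^ₛ (2 ℕ.* m)) ⟨
  cube (φ m)  ∎
  where
  open ≗-Reasoning
  2*3*m≡3*2*m : 2 ℕ.* (3 ℕ.* m) ≡ 3 ℕ.* (2 ℕ.* m)
  2*3*m≡3*2*m = trans (sym (ℕ.*-assoc 2 3 m)) (ℕ.*-assoc 3 2 m)

partialProd₃-suc-cube : ∀ K → partialProd₃ (suc K) ≗ φ 1 *ₛ cube (partialProd₃ K)
partialProd₃-suc-cube zero = begin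
  partialProd₃ 1                ≈⟨ partialProd₃-suc 0 ⟩
  φ 1 *ₛ partialProd₃ 0         ≈⟨ *ₛ-cong ≗-refl (≗-trans partialProd₃-zero (≗-sym cube-1)) ⟩
  φ 1 *ₛ cube 1ₛ                ≈⟨ *ₛ-cong ≗-refl (cube-cong partialProd₃-zero) ⟨
  φ 1 *ₛ cube (partialProd₃ 0)  ∎
  where
  open ≗-Reasoning
  cube-1 : cube 1ₛ ≗ 1ₛ
  cube-1 = solve 0 (con 1₃ :* con 1₃ :* con 1₃ := con 1₃) ≗-refl

partialProd₃-suc-cube (suc K) = begin
  partialProd₃ (2 ℕ.+ K)                                   ≈⟨ partialProd₃-suc (suc K) ⟩
  φ (3 ℕ.* 3 ^ K) *ₛ partialProd₃ (suc K)                  ≈⟨ *ₛ-cong (φ-3* (3 ^ K)) (partialProd₃-suc-cube K) ⟩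
  cube (φ (3 ^ K)) *ₛ (φ 1 *ₛ cube (partialProd₃ K))        ≈⟨ regroup (φ (3 ^ K)) (φ 1) (partialProd₃ K) ⟩
  φ 1 *ₛ cube (φ (3 ^ K) *ₛ partialProd₃ K)                ≈⟨ *ₛ-cong ≗-refl (cube-cong (partialProd₃-suc K)) ⟨
  φ 1 *ₛ cube (partialProd₃ (suc K))                       ∎
  where
  open ≗-Reasoning
  regroup : ∀ a p b → cube a *ₛ (p *ₛ cube b) ≗ p *ₛ cube (a *ₛ b)
  regroup = solve 3 (λ a p b → a :* a :* a :* (p :* (b :* b :* b)) := p :* ((a :* b) :* (a :* b) :* (a :* b))) ≗-refl

n<3^n : ∀ n → n ℕ.< 3 ^ n
n<3^n zero    = ℕ.z<s
n<3^n (suc n) = ℕ.≤-trans (ℕ.+-mono-≤ (ℕ.≤-trans ℕ.z<s (n<3^n n)) (n<3^n n))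
                          (ℕ.+-monoʳ-≤ (3 ^ n) (ℕ.m≤m+n (3 ^ n) _))

partialProd₃-stable : ∀ K q → q ℕ.< 3 ^ K → partialProd₃ (suc K) q ≡ partialProd₃ K q
partialProd₃-stable K q q<3^K = begin
  partialProd₃ (suc K) q
    ≡⟨ mod₃-mulFactor (3 ^ K) (partialProd K) q ⟩
  partialProd₃ K q +₃ -₃ shiftBy (3 ^ K) (partialProd₃ K) q +₃ -₃ shiftBy (2 ℕ.* 3 ^ K) (partialProd₃ K) q
    ≡⟨ cong₂ (λ a b → partialProd₃ K q +₃ -₃ a +₃ -₃ b) (shiftBy-below (3 ^ K) _ q q<3^K)
             (shiftBy-below (2 ℕ.* 3 ^ K) _ q (ℕ.<-≤-trans q<3^K (ℕ.m≤m+n (3 ^ K) _))) ⟩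
  partialProd₃ K q +₃ 0₃ +₃ 0₃
    ≡⟨ trans (+₃-identityʳ _) (+₃-identityʳ _) ⟩
  partialProd₃ K q  ∎
  where open ≡-Reasoning

f₃ : Series₃
f₃ n = mod₃ (fCoeff n)

partialProd₃-+ : ∀ q d → partialProd₃ (q ℕ.+ d) q ≡ f₃ q
partialProd₃-+ q zero    = trans (cong (λ K → partialProd₃ K q) (ℕ.+-identityʳ q))
                                 (sym (partialProd₃-stable q q (n<3^n q)))
partialProd₃-+ q (suc d) = begin
  partialProd₃ (q ℕ.+ suc d) q
    ≡⟨ cong (λ K → partialProd₃ K q) (ℕ.+-suc q d) ⟩
  partialProd₃ (suc (q ℕ.+ d)) q
    ≡⟨ partialProd₃-stable (q ℕ.+ d) q (ℕ.≤-<-trans (ℕ.m≤m+n q d) (n<3^n (q ℕ.+ d))) ⟩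
  partialProd₃ (q ℕ.+ d) q
    ≡⟨ partialProd₃-+ q d ⟩
  f₃ q  ∎
  where open ≡-Reasoning

AgreeUpTo : ℕ → Series₃ → Series₃ → Set
AgreeUpTo n A B = ∀ m → m ℕ.≤ n → A m ≡ B m

partialProd₃-agrees : ∀ n → AgreeUpTo n (partialProd₃ n) f₃
partialProd₃-agrees n q q≤n = trans (cong (λ K → partialProd₃ K q) (sym (ℕ.m+[n∸m]≡n q≤n))) (partialProd₃-+ q (n ∸ q))

*ₛ-coeff-local : ∀ n {A A′ B B′} → AgreeUpTo n A A′ → AgreeUpTo n B B′ → (A *ₛ B) n ≡ (A′ *ₛ B′) n
*ₛ-coeff-local zero    A≗A′ B≗B′ = cong₂ _*₃_ (A≗A′ 0 ℕ.z≤n) (B≗B′ 0 ℕ.z≤n)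
*ₛ-coeff-local (suc n) A≗A′ B≗B′ =
  cong₂ _+₃_ (cong₂ _*₃_ (A≗A′ 0 ℕ.z≤n) (B≗B′ (suc n) ℕ.≤-refl))
             (*ₛ-coeff-local n (λ m m≤n → A≗A′ (suc m) (ℕ.s≤s m≤n)) (λ m m≤n → B≗B′ m (ℕ.m≤n⇒m≤1+n m≤n)))

*ₛ-agree : ∀ {n A A′ B B′} → AgreeUpTo n A A′ → AgreeUpTo n B B′ → AgreeUpTo n (A *ₛ B) (A′ *ₛ B′)
*ₛ-agree A≗A′ B≗B′ m m≤n =
  *ₛ-coeff-local m (λ k k≤m → A≗A′ k (ℕ.≤-trans k≤m m≤n)) (λ k k≤m → B≗B′ k (ℕ.≤-trans k≤m m≤n))

-- [xⁿ] (φ P_n³) only involves coefficients of P_n up to n, where P_n already agrees with f₃.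
f₃-functional : f₃ ≗ φ 1 *ₛ cube f₃
f₃-functional n = begin
  partialProd₃ (suc n) n
    ≡⟨ partialProd₃-suc-cube n n ⟩
  (φ 1 *ₛ cube (partialProd₃ n)) n
    ≡⟨ *ₛ-agree (λ _ _ → refl) (*ₛ-agree (*ₛ-agree agree agree) agree) n ℕ.≤-refl ⟩
  (φ 1 *ₛ cube f₃) n  ∎
  where
  open ≡-Reasoning
  agree = partialProd₃-agrees n

-- The continued fraction of f modulo 3

*ₛ-cancelˡ : ∀ A B → A 0 ≡ 1₃ → A *ₛ B ≗ 0ₛ → B ≗ 0ₛ
*ₛ-cancelˡ A B A₀≡1 AB≗0 n = vanishes-upTo n n ℕ.≤-refl
  where
  vanishes-upTo : ∀ n m → m ℕ.≤ n → B m ≡ 0₃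
  vanishes-upTo zero    zero    _   = trans (cong (_*₃ B 0) (sym A₀≡1)) (AB≗0 0)
  vanishes-upTo (suc n) m       m≤1+n with m ℕ.≟ suc n
  ... | no  m≢1+n = vanishes-upTo n m (ℕ.≤-pred (ℕ.≤∧≢⇒< m≤1+n m≢1+n))
  ... | yes refl  = begin
    B (suc n)                                      ≡⟨ +₃-identityʳ (B (suc n)) ⟨
    B (suc n) +₃ 0₃                                ≡⟨ cong₂ (λ a z → a *₃ B (suc n) +₃ z) (sym A₀≡1) (sym tail≡0) ⟩
    A 0 *₃ B (suc n) +₃ ((A ∘ suc) *ₛ B) n         ≡⟨ AB≗0 (suc n) ⟩
    0₃                                             ∎
    where
    open ≡-Reasoning
    tail≡0 : ((A ∘ suc) *ₛ B) n ≡ 0₃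
    tail≡0 = trans (*ₛ-coeff-local n (λ _ _ → refl) (λ m m≤n → vanishes-upTo n m m≤n))
                   (≗-trans (*ₛ-comm (A ∘ suc) 0ₛ) (*ₛ-zeroˡ (A ∘ suc)) n)

shift-injective : ∀ {A B} → shift A ≗ shift B → A ≗ B
shift-injective sA≗sB n = sA≗sB (suc n)

≗-from-difference : ∀ A B → A +ₛ -ₛ B ≗ 0ₛ → A ≗ B
≗-from-difference A B A-B≗0 = begin
  A                       ≈⟨ solve 2 (λ a b → a := (a :+ :- b) :+ b) ≗-refl A B ⟩
  (A +ₛ -ₛ B) +ₛ B        ≈⟨ +ₛ-cong A-B≗0 ≗-refl ⟩
  0ₛ +ₛ B                 ≈⟨ ≗-refl ⟩
  B                       ∎
  where open ≗-Reasoning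

d : Series₃
d = φ 1 *ₛ f₃

f₃-*-d : f₃ *ₛ d ≗ 1ₛ
f₃-*-d = ≗-from-difference _ _ (*ₛ-cancelˡ f₃ (f₃ *ₛ d +ₛ -ₛ 1ₛ) refl (begin
  f₃ *ₛ (f₃ *ₛ (φ 1 *ₛ f₃) +ₛ -ₛ 1ₛ)
    ≈⟨ solve 2 (λ f p → f :* (f :* (p :* f) :+ :- con 1₃) := p :* (f :* f :* f) :+ :- f) ≗-refl f₃ (φ 1) ⟩
  φ 1 *ₛ cube f₃ +ₛ -ₛ f₃
    ≈⟨ +ₛ-cong (≗-sym f₃-functional) ≗-refl ⟩
  f₃ +ₛ -ₛ f₃
    ≈⟨ (λ n → -₃-inverseʳ (f₃ n)) ⟩
  0ₛ  ∎))
  where open ≗-Reasoning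

d-*-d : d *ₛ d ≗ φ 1
d-*-d = begin
  φ 1 *ₛ f₃ *ₛ (φ 1 *ₛ f₃)     ≈⟨ solve 2 (λ p f → p :* f :* (p :* f) := p :* (f :* (p :* f))) ≗-refl (φ 1) f₃ ⟩
  φ 1 *ₛ (f₃ *ₛ d)             ≈⟨ *ₛ-cong ≗-refl f₃-*-d ⟩
  φ 1 *ₛ 1ₛ                    ≈⟨ solve 1 (λ p → p :* con 1₃ := p) ≗-refl (φ 1) ⟩
  φ 1                          ∎
  where open ≗-Reasoning

-- The constant term of 1 + x - d vanishes, so this is its quotient by x.
y : Series₃
y n = (1ₛ +ₛ X +ₛ -ₛ d) (suc n)

X-*-y : X *ₛ y ≗ 1ₛ +ₛ X +ₛ -ₛ d
X-*-y = ≗-trans (X-*ₛ y) (λ { zero → refl ; (suc n) → refl })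

φ1≗1-X-X² : φ 1 ≗ 1ₛ +ₛ -ₛ X +ₛ -ₛ (X *ₛ X)
φ1≗1-X-X² = solve 1 (λ x → con 1₃ :+ :- (x :* con 1₃) :+ :- (x :* (x :* con 1₃)) := con 1₃ :+ :- x :+ :- (x :* x)) ≗-refl X

-- In characteristic 3, d² = 1 - x - x² with d = 1 + x - xy becomes y = x(1 - y - y²).
y-equation : y ≗ X *ₛ (1ₛ +ₛ -ₛ y +ₛ -ₛ (y *ₛ y))
y-equation = shift-injective (begin
  shift y
    ≈⟨ X-*ₛ y ⟨
  X *ₛ y
    ≈⟨ X-*-y ⟩
  1ₛ +ₛ X +ₛ -ₛ d
    ≈⟨ rearrange X d ⟩
  u +ₛ (d *ₛ d +ₛ -ₛ w)
    ≈⟨ +ₛ-cong {A = u} ≗-refl (+ₛ-cong {B = -ₛ w} (≗-trans d-*-d φ1≗1-X-X²) ≗-refl) ⟩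
  u +ₛ (w +ₛ -ₛ w)
    ≈⟨ solve 2 (λ u w → u :+ (w :+ :- w) := u) ≗-refl u w ⟩
  u
    ≈⟨ +ₛ-cong (+ₛ-cong ≗-refl (-ₛ-cong (*ₛ-cong ≗-refl X-*-y))) (-ₛ-cong (*ₛ-cong X-*-y X-*-y)) ⟨
  X *ₛ X +ₛ -ₛ (X *ₛ (X *ₛ y)) +ₛ -ₛ ((X *ₛ y) *ₛ (X *ₛ y))
    ≈⟨ factor X y ⟩
  X *ₛ (X *ₛ (1ₛ +ₛ -ₛ y +ₛ -ₛ (y *ₛ y)))
    ≈⟨ X-*ₛ _ ⟩
  shift (X *ₛ (1ₛ +ₛ -ₛ y +ₛ -ₛ (y *ₛ y)))  ∎)
  where
  open ≗-Reasoning
  z w u : Series₃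
  z = 1ₛ +ₛ X +ₛ -ₛ d
  w = 1ₛ +ₛ -ₛ X +ₛ -ₛ (X *ₛ X)
  u = X *ₛ X +ₛ -ₛ (X *ₛ z) +ₛ -ₛ (z *ₛ z)
  rearrange : ∀ x d → 1ₛ +ₛ x +ₛ -ₛ d ≗
    x *ₛ x +ₛ -ₛ (x *ₛ (1ₛ +ₛ x +ₛ -ₛ d)) +ₛ -ₛ ((1ₛ +ₛ x +ₛ -ₛ d) *ₛ (1ₛ +ₛ x +ₛ -ₛ d)) +ₛ
    (d *ₛ d +ₛ -ₛ (1ₛ +ₛ -ₛ x +ₛ -ₛ (x *ₛ x)))
  rearrange = solve 2 (λ x d → con 1₃ :+ x :+ :- d :=
    x :* x :+ :- (x :* (con 1₃ :+ x :+ :- d)) :+ :- ((con 1₃ :+ x :+ :- d) :* (con 1₃ :+ x :+ :- d)) :+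
    (d :* d :+ :- (con 1₃ :+ :- x :+ :- (x :* x)))) ≗-refl
  factor : ∀ x y → x *ₛ x +ₛ -ₛ (x *ₛ (x *ₛ y)) +ₛ -ₛ ((x *ₛ y) *ₛ (x *ₛ y)) ≗
                   x *ₛ (x *ₛ (1ₛ +ₛ -ₛ y +ₛ -ₛ (y *ₛ y)))
  factor = solve 2 (λ x y → x :* x :+ :- (x :* (x :* y)) :+ :- ((x :* y) :* (x :* y)) :=
                            x :* (x :* (con 1₃ :+ :- y :+ :- (y :* y)))) ≗-refl

f₃·y^ : ℕ → Series₃
f₃·y^ zero    = f₃
f₃·y^ (suc k) = f₃·y^ k *ₛ y

f₃-recurrence : f₃ ≗ 1ₛ +ₛ X *ₛ (-ₛ f₃ +ₛ f₃ *ₛ y)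
f₃-recurrence = ≗-sym (begin
  1ₛ +ₛ X *ₛ (-ₛ f₃ +ₛ f₃ *ₛ y)
    ≈⟨ expand f₃ X y ⟩
  1ₛ +ₛ -ₛ (X *ₛ f₃) +ₛ f₃ *ₛ (X *ₛ y)
    ≈⟨ +ₛ-cong {A = 1ₛ +ₛ -ₛ (X *ₛ f₃)} ≗-refl (*ₛ-cong ≗-refl X-*-y) ⟩
  1ₛ +ₛ -ₛ (X *ₛ f₃) +ₛ f₃ *ₛ (1ₛ +ₛ X +ₛ -ₛ d)
    ≈⟨ collect f₃ X d ⟩
  f₃ +ₛ (1ₛ +ₛ -ₛ (f₃ *ₛ d))
    ≈⟨ +ₛ-cong {A = f₃} ≗-refl (+ₛ-cong {A = 1ₛ} ≗-refl (-ₛ-cong f₃-*-d)) ⟩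
  f₃ +ₛ (1ₛ +ₛ -ₛ 1ₛ)
    ≈⟨ (λ n → cong (f₃ n +₃_) (-₃-inverseʳ (1ₛ n))) ⟩
  f₃ +ₛ 0ₛ
    ≈⟨ (λ n → +₃-identityʳ (f₃ n)) ⟩
  f₃  ∎)
  where
  open ≗-Reasoning
  expand : ∀ f x y → 1ₛ +ₛ x *ₛ (-ₛ f +ₛ f *ₛ y) ≗ 1ₛ +ₛ -ₛ (x *ₛ f) +ₛ f *ₛ (x *ₛ y)
  expand = solve 3 (λ f x y → con 1₃ :+ x :* (:- f :+ f :* y) := con 1₃ :+ :- (x :* f) :+ f :* (x :* y)) ≗-refl
  collect : ∀ f x d → 1ₛ +ₛ -ₛ (x *ₛ f) +ₛ f *ₛ (1ₛ +ₛ x +ₛ -ₛ d) ≗ f +ₛ (1ₛ +ₛ -ₛ (f *ₛ d))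
  collect = solve 3 (λ f x d → con 1₃ :+ :- (x :* f) :+ f :* (con 1₃ :+ x :+ :- d) := f :+ (con 1₃ :+ :- (f :* d))) ≗-refl

f₃·y^-recurrence : ∀ k → f₃·y^ (suc k) ≗ X *ₛ (f₃·y^ k +ₛ -ₛ f₃·y^ (suc k) +ₛ -ₛ f₃·y^ (2 ℕ.+ k))
f₃·y^-recurrence k = begin
  f₃·y^ k *ₛ y
    ≈⟨ *ₛ-cong ≗-refl y-equation ⟩
  f₃·y^ k *ₛ (X *ₛ (1ₛ +ₛ -ₛ y +ₛ -ₛ (y *ₛ y)))
    ≈⟨ distribute (f₃·y^ k) X y ⟩
  X *ₛ (f₃·y^ k +ₛ -ₛ f₃·y^ (suc k) +ₛ -ₛ f₃·y^ (2 ℕ.+ k)) ∎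
  where
  open ≗-Reasoning
  distribute : ∀ t x y → t *ₛ (x *ₛ (1ₛ +ₛ -ₛ y +ₛ -ₛ (y *ₛ y))) ≗ x *ₛ (t +ₛ -ₛ (t *ₛ y) +ₛ -ₛ (t *ₛ y *ₛ y))
  distribute = solve 3 (λ t x y → t :* (x :* (con 1₃ :+ :- y :+ :- (y :* y))) :=
                                  x :* (t :+ :- (t :* y) :+ :- (t :* y :* y))) ≗-refl

-- f ≡ 1/(1 + x - x²/(1 + x + x²/(1 + x + x²/(1 + x + …)))) (mod 3), i.e. b k = -1,
-- Λ 1 = 1 and Λ (k + 2) = -1.
Λ : ℕ → F₃
Λ (suc (suc _)) = -₃ 1₃
Λ _             = 1₃

f₃·y^-top : ∀ k → f₃·y^ (suc k) 0 ≡ 0₃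
f₃·y^-top k = f₃·y^-recurrence k 0

f₃·y^-step₀ : ∀ n → f₃·y^ 0 (suc n) ≡ -₃ 1₃ *₃ f₃·y^ 0 n +₃ Λ 1 *₃ f₃·y^ 1 n
f₃·y^-step₀ n = trans (f₃-recurrence (suc n)) (trans (X-*ₛ _ (suc n)) (as-scalars (f₃·y^ 0 n) (f₃·y^ 1 n)))
  where
  as-scalars : ∀ a b → -₃ a +₃ b ≡ -₃ 1₃ *₃ a +₃ 1₃ *₃ b
  as-scalars = solve-∀ F₃-ring

f₃·y^-step : ∀ n k → f₃·y^ (suc k) (suc n) ≡
  f₃·y^ k n +₃ -₃ 1₃ *₃ f₃·y^ (suc k) n +₃ Λ (2 ℕ.+ k) *₃ f₃·y^ (2 ℕ.+ k) n
f₃·y^-step n k = trans (f₃·y^-recurrence k (suc n))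
  (trans (X-*ₛ _ (suc n)) (as-scalars (f₃·y^ k n) (f₃·y^ (suc k) n) (f₃·y^ (2 ℕ.+ k) n)))
  where
  as-scalars : ∀ a b c → a +₃ -₃ b +₃ -₃ c ≡ a +₃ -₃ 1₃ *₃ b +₃ -₃ 1₃ *₃ c
  as-scalars = solve-∀ F₃-ring

open StieltjesTableau (λ n k → f₃·y^ k n) (λ _ → -₃ 1₃) Λ refl f₃·y^-top f₃·y^-step₀ f₃·y^-step

theorem2p7 : (n : ℕ) → hankel (suc n) fCoeff ≢ 0ℤ
theorem2p7 n H≡0 = product-nonzero {suc n} (λ k → weight (toℕ k)) (λ k → weight-nonzero Λ≢0 (toℕ k)) (begin
  product {suc n} (λ k → weight (toℕ k))           ≡⟨ det₃-hankel (suc n) ⟨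
  det₃ (suc n) (λ i j → f₃ (toℕ i ℕ.+ toℕ j))      ≡⟨ mod₃-det (suc n) (λ i j → fCoeff (toℕ i ℕ.+ toℕ j)) ⟨
  mod₃ (hankel (suc n) fCoeff)                     ≡⟨ cong mod₃ H≡0 ⟩
  0₃                                               ∎)
  where
  open ≡-Reasoning
  Λ≢0 : ∀ k → Λ (suc k) ≢ 0₃
  Λ≢0 zero    = λ ()
  Λ≢0 (suc k) = λ ()
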